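{- For every nonnegative integer $n$, there are at least $n!$ pairwise non-isomorphic matroids on $4n+5$ elements, each of cyclic width at most $2$, whose lattices of cyclic flats are all isomorphic to one another.
   Context: A flat is cyclic if it is a (possibly empty) union of circuits; the cyclic flats of a matroid ordered by inclusion form a lattice. The cyclic width of $M$ is the maximum size of an antichain in this lattice. -}

module Defs where

open import Data.Nat using (ℕ; _<_; _≤_)
open import Data.Bool using (Bool; true)
open import Data.Fin using (Fin)
open import Data.Fin.Subset using (Subset; _∈_; _∉_; _⊆_; _∪_; _-_; ⁅_⁆; ∣_∣) renaming (⊥ to ∅)
open import Data.Fin.Permutation using (Permutation; _⟨$⟩ˡ_)
open import Data.Vec using (tabulate; lookup)
open import Data.List using (List; length)
open import Data.List.Relation.Unary.All using (All)
open import Data.List.Relation.Unary.AllPairs using (AllPairs)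
open import Data.Product using (Σ; ∃; _×_)
open import Relation.Nullary using (¬_)
open import Relation.Binary.PropositionalEquality using (_≡_)

record Matroid (m : ℕ) : Set where
  field
    indep   : Subset m → Bool
    indep-∅ : indep ∅ ≡ true
    indep-⊆ : ∀ X Y → Y ⊆ X → indep X ≡ true → indep Y ≡ true
    augment : ∀ X Y → indep X ≡ true → indep Y ≡ true → ∣ X ∣ < ∣ Y ∣ →
              ∃ λ e → e ∈ Y × e ∉ X × indep (⁅ e ⁆ ∪ X) ≡ true

module _ {m : ℕ} (M : Matroid m) where
  open Matroid M

  Independent : Subset m → Set
  Independent X = indep X ≡ true

  IsCircuit : Subset m → Set
  IsCircuit C = ¬ Independent C × (∀ e → e ∈ C → Independent (C - e))

  HasRank : Subset m → ℕ → Set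
  HasRank X k = (Σ (Subset m) λ I → I ⊆ X × Independent I × ∣ I ∣ ≡ k)
              × (∀ I → I ⊆ X → Independent I → ∣ I ∣ ≤ k)

  IsFlat : Subset m → Set
  IsFlat F = ∀ e → e ∉ F → ∀ k → HasRank F k → ¬ HasRank (⁅ e ⁆ ∪ F) k

  IsCyclic : Subset m → Set
  IsCyclic F = ∀ e → e ∈ F → Σ (Subset m) λ C → IsCircuit C × e ∈ C × C ⊆ F

  IsCyclicFlat : Subset m → Set
  IsCyclicFlat F = IsFlat F × IsCyclic F

  -- antichain in the lattice of cyclic flats (ordered by inclusion):
  -- a list of cyclic flats, pairwise incomparable (hence pairwise distinct)
  IsCFAntichain : List (Subset m) → Set
  IsCFAntichain xs = All IsCyclicFlat xs
                   × AllPairs (λ X Y → ¬ X ⊆ Y × ¬ Y ⊆ X) xs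

  CyclicWidth≤ : ℕ → Set
  CyclicWidth≤ w = ∀ xs → IsCFAntichain xs → length xs ≤ w

image : {m n : ℕ} → Permutation m n → Subset m → Subset n
image π X = tabulate (λ y → lookup X (π ⟨$⟩ˡ y))

MatroidIso : {m n : ℕ} → Matroid m → Matroid n → Set
MatroidIso {m} {n} M N =
  Σ (Permutation m n) λ π → ∀ X → Matroid.indep N (image π X) ≡ Matroid.indep M X

record CFLatticeIso {m n : ℕ} (M : Matroid m) (N : Matroid n) : Set where
  field
    to       : Subset m → Subset n
    from     : Subset n → Subset m
    to-cf    : ∀ X → IsCyclicFlat M X → IsCyclicFlat N (to X)
    from-cf  : ∀ Y → IsCyclicFlat N Y → IsCyclicFlat M (from Y)
    from-to  : ∀ X → IsCyclicFlat M X → from (to X) ≡ X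
    to-from  : ∀ Y → IsCyclicFlat N Y → to (from Y) ≡ Y
    to-mono  : ∀ X X′ → IsCyclicFlat M X → IsCyclicFlat M X′ → X ⊆ X′ → to X ⊆ to X′
    from-mono : ∀ Y Y′ → IsCyclicFlat N Y → IsCyclicFlat N Y′ → Y ⊆ Y′ → from Y ⊆ from Y′

{-# OPTIONS --safe #-}
-- Fix n and a permutation σ of Fin n. Split a ground set of 4n+5 elements into blocks A, B, C, D
-- of sizes n+2, n+3, n, n, and consider the two chains X_i = A ∪ C_{<i} ∪ D_{<i} and
-- Y_j = B ∪ C_{<j} ∪ D_{σ<j} (0 ≤ i, j ≤ n), where D_{σ<j} is the set of d with σ d < j. Declare
-- a set independent when it meets each X_i and Y_i in at most n+1+i elements and the whole ground
-- set in at most 2n+2. The cyclic flats of this matroid are exactly ∅, the X_i, the Y_j and the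
-- ground set: two chains between a bottom and a top, whatever σ is. So the cyclic width is 2 and
-- all the lattices are isomorphic. An isomorphism between two of these matroids maps cyclic flats to
-- cyclic flats of the same size. Since the sizes tell the cyclic flats apart, it maps each X_i and
-- Y_j to its namesake. Then the sizes of (X_{i+1} ─ X_i) ∩ Y_j recover σ, so the n! permutations
-- give pairwise non-isomorphic matroids.

module Submission where

open import Defs
open import Data.Nat using (ℕ; zero; suc; _+_; _*_; _!; _≤_; _<_; z≤n; s≤s; z<s; s≤s⁻¹; _≤?_; _<ᵇ_; _≟_)
open import Data.Nat.Properties
open import Data.Nat.Solver using (module +-*-Solver)
open import Data.Bool using (Bool; true; false; if_then_else_; _∧_)
open import Data.Bool.Properties using (T-≡) renaming (_≟_ to _≟ᵇ_)
open import Data.Fin using (Fin; zero; suc; toℕ; inject₁; remQuot; combine; punchIn)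
import Data.Fin.Properties as Fin
open import Data.Fin.Subset renaming (⊥ to ∅)
open import Data.Fin.Subset.Properties
open import Data.Fin.Permutation
  using (Permutation; Permutation′; _⟨$⟩ˡ_; _⟨$⟩ʳ_; _≈_; flip; inverseˡ; inverseʳ; id; insert)
open import Data.Vec using ([]; _∷_; _++_; zipWith; tabulate; lookup; here; there)
open import Data.Vec.Properties
  using ([]=⇒lookup; lookup⇒[]=; lookup∘tabulate; tabulate∘lookup; tabulate-cong; lookup-zipWith; zipWith-++)
open import Data.List using (List; []; _∷_; map; allFin) renaming (_++_ to _++ˡ_)
open import Data.List.Membership.Propositional using () renaming (_∈_ to _∈ˡ_)
open import Data.List.Membership.Propositional.Properties using (∈-map⁺; ∈-++⁺ˡ; ∈-++⁺ʳ; ∈-allFin)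
open import Data.List.Relation.Unary.Any using (here; there; satisfied)
import Data.List.Relation.Unary.All as All
open import Data.List.Relation.Unary.All using (_∷_)
open import Data.List.Relation.Unary.All.Properties using (¬All⇒Any¬)
open import Data.List.Relation.Unary.AllPairs using (_∷_)
open import Data.Product using (Σ; ∃; _×_; _,_; proj₁; proj₂; uncurry)
open import Data.Sum using (_⊎_; inj₁; inj₂; [_,_]′)
import Data.Sum as Sum
open import Data.Empty using (⊥-elim)
open import Function using (_∘_; _$_; Equivalence)
open import Relation.Nullary
  using (¬_; Dec; yes; no; does; proof; Reflects; invert; contradiction; ⌊_⌋; _×-dec_; ¬?; _→-dec_)
import Relation.Nullary.Decidable as Dec
open import Relation.Binary using (tri<; tri≈; tri>)
open import Relation.Binary.PropositionalEquality
open import Algebra.Properties.CommutativeMonoid.Sum +-0-commutativeMonoid using (sum; sum-permute)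

private variable
  m n : ℕ
  x y : Fin n
  p q r : Subset n

x∈p─q⁻ : ∀ (p q : Subset n) → x ∈ p ─ q → x ∈ p × x ∉ q
x∈p─q⁻ (true ∷ p) (false ∷ q) here = here , λ ()
x∈p─q⁻ {x = zero} (false ∷ p) (false ∷ q) ()
x∈p─q⁻ {x = zero} (_ ∷ p) (true ∷ q) ()
x∈p─q⁻ (_ ∷ p) (_ ∷ q) (there x∈) =
  there (proj₁ (x∈p─q⁻ p q x∈)) , proj₂ (x∈p─q⁻ p q x∈) ∘ drop-there

x∈p-y⁻ : ∀ (p : Subset n) → x ∈ p - y → x ∈ p × x ≢ y
x∈p-y⁻ {y = y} p x∈ with x∈p─q⁻ p ⁅ y ⁆ x∈
... | x∈p , x∉⁅y⁆ = x∈p , x∉⁅y⁆⇒x≢y x∉⁅y⁆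

p⊆q⇒p─r⊆q─r : p ⊆ q → p ─ r ⊆ q ─ r
p⊆q⇒p─r⊆q─r {p = p} {r = r} p⊆q x∈ = let x∈p , x∉r = x∈p─q⁻ p r x∈ in x∈p∧x∉q⇒x∈p─q (p⊆q x∈p) x∉r

p⊈q⇒∃∈p∉q : ¬ p ⊆ q → ∃ λ x → x ∈ p × x ∉ q
p⊈q⇒∃∈p∉q {n} {p} {q} p⊈q
  with Fin.¬∀⟶∃¬ n (λ x → x ∈ p → x ∈ q) (λ x → x ∈? p →-dec x ∈? q) (λ f → p⊈q (f _))
... | x , ¬[x∈p→x∈q] with x ∈? p | x ∈? q
...   | yes x∈p | no x∉q = x , x∈p , x∉q
...   | _       | yes x∈q = contradiction (λ _ → x∈q) ¬[x∈p→x∈q]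
...   | no x∉p  | _ = contradiction (λ x∈p → contradiction x∈p x∉p) ¬[x∈p→x∈q]

⁅x⁆∪p⊆q : x ∈ q → p ⊆ q → ⁅ x ⁆ ∪ p ⊆ q
⁅x⁆∪p⊆q {x = x} {p = p} x∈q p⊆q y∈ with x∈p∪q⁻ ⁅ x ⁆ p y∈
... | inj₁ y∈⁅x⁆ rewrite x∈⁅y⁆⇒x≡y x y∈⁅x⁆ = x∈q
... | inj₂ y∈p = p⊆q y∈p

x∈tabulate⁻ : ∀ {f : Fin n → Bool} → x ∈ tabulate f → f x ≡ true
x∈tabulate⁻ {x = x} {f = f} x∈ = trans (sym (lookup∘tabulate f x)) ([]=⇒lookup x∈)

x∈tabulate⁺ : ∀ {f : Fin n → Bool} → f x ≡ true → x ∈ tabulate f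
x∈tabulate⁺ {x = x} {f = f} fx = lookup⇒[]= x _ (trans (lookup∘tabulate f x) fx)

x∈p⇒0<∣p∣ : x ∈ p → 0 < ∣ p ∣
x∈p⇒0<∣p∣ {p = true ∷ p} _ = s≤s z≤n
x∈p⇒0<∣p∣ {p = false ∷ p} (there x∈p) = x∈p⇒0<∣p∣ x∈p

Empty⇒∣p∣≡0 : Empty p → ∣ p ∣ ≡ 0
Empty⇒∣p∣≡0 {n} p-empty = trans (cong ∣_∣ (Empty-unique p-empty)) (∣⊥∣≡0 n)

p⊆q⇒∣p─q∣≡0 : p ⊆ q → ∣ p ─ q ∣ ≡ 0
p⊆q⇒∣p─q∣≡0 {p = p} {q = q} p⊆q = Empty⇒∣p∣≡0 λ (x , x∈) → let x∈p , x∉q = x∈p─q⁻ p q x∈ in x∉q (p⊆q x∈p)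

p⊆q⇒∣q∣≤∣p∣⇒q⊆p : p ⊆ q → ∣ q ∣ ≤ ∣ p ∣ → q ⊆ p
p⊆q⇒∣q∣≤∣p∣⇒q⊆p {p = p} p⊆q ∣q∣≤∣p∣ {x} x∈q with x ∈? p
... | yes x∈p = x∈p
... | no x∉p = contradiction ∣q∣≤∣p∣ (<⇒≱ (p⊂q⇒∣p∣<∣q∣ (p⊆q , x , x∈q , x∉p)))

∣p∣≡∣p∩q∣+∣p─q∣ : ∀ (p q : Subset n) → ∣ p ∣ ≡ ∣ p ∩ q ∣ + ∣ p ─ q ∣
∣p∣≡∣p∩q∣+∣p─q∣ [] [] = refl
∣p∣≡∣p∩q∣+∣p─q∣ (true ∷ p) (true ∷ q) = cong suc (∣p∣≡∣p∩q∣+∣p─q∣ p q)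
∣p∣≡∣p∩q∣+∣p─q∣ (true ∷ p) (false ∷ q) =
  trans (cong suc (∣p∣≡∣p∩q∣+∣p─q∣ p q)) (sym (+-suc _ _))
∣p∣≡∣p∩q∣+∣p─q∣ (false ∷ p) (true ∷ q) = ∣p∣≡∣p∩q∣+∣p─q∣ p q
∣p∣≡∣p∩q∣+∣p─q∣ (false ∷ p) (false ∷ q) = ∣p∣≡∣p∩q∣+∣p─q∣ p q

q⊆p⇒∣p∣≡∣q∣+∣p─q∣ : q ⊆ p → ∣ p ∣ ≡ ∣ q ∣ + ∣ p ─ q ∣
q⊆p⇒∣p∣≡∣q∣+∣p─q∣ {q = q} {p = p} q⊆p =
  trans (∣p∣≡∣p∩q∣+∣p─q∣ p q) (cong (λ s → ∣ s ∣ + ∣ p ─ q ∣) p∩q≡q)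
  where
  p∩q≡q : p ∩ q ≡ q
  p∩q≡q = ⊆-antisym (p∩q⊆q p q) (λ x∈ → x∈p∩q⁺ (q⊆p x∈ , x∈))

∣r∩[p∪q]∣+∣r∩[p∩q]∣≡∣r∩p∣+∣r∩q∣ : ∀ (r p q : Subset n) →
  ∣ r ∩ (p ∪ q) ∣ + ∣ r ∩ (p ∩ q) ∣ ≡ ∣ r ∩ p ∣ + ∣ r ∩ q ∣
∣r∩[p∪q]∣+∣r∩[p∩q]∣≡∣r∩p∣+∣r∩q∣ [] [] [] = refl
∣r∩[p∪q]∣+∣r∩[p∩q]∣≡∣r∩p∣+∣r∩q∣ (false ∷ r) (_ ∷ p) (_ ∷ q) =
  ∣r∩[p∪q]∣+∣r∩[p∩q]∣≡∣r∩p∣+∣r∩q∣ r p q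
∣r∩[p∪q]∣+∣r∩[p∩q]∣≡∣r∩p∣+∣r∩q∣ (true ∷ r) (true ∷ p) (true ∷ q) =
  cong suc (trans (+-suc _ _) (trans (cong suc (∣r∩[p∪q]∣+∣r∩[p∩q]∣≡∣r∩p∣+∣r∩q∣ r p q)) (sym (+-suc _ _))))
∣r∩[p∪q]∣+∣r∩[p∩q]∣≡∣r∩p∣+∣r∩q∣ (true ∷ r) (true ∷ p) (false ∷ q) =
  cong suc (∣r∩[p∪q]∣+∣r∩[p∩q]∣≡∣r∩p∣+∣r∩q∣ r p q)
∣r∩[p∪q]∣+∣r∩[p∩q]∣≡∣r∩p∣+∣r∩q∣ (true ∷ r) (false ∷ p) (true ∷ q) =
  trans (cong suc (∣r∩[p∪q]∣+∣r∩[p∩q]∣≡∣r∩p∣+∣r∩q∣ r p q)) (sym (+-suc _ _))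
∣r∩[p∪q]∣+∣r∩[p∩q]∣≡∣r∩p∣+∣r∩q∣ (true ∷ r) (false ∷ p) (false ∷ q) =
  ∣r∩[p∪q]∣+∣r∩[p∩q]∣≡∣r∩p∣+∣r∩q∣ r p q

x∉p⇒∣⁅x⁆∪p∣≡1+∣p∣ : x ∉ p → ∣ ⁅ x ⁆ ∪ p ∣ ≡ suc ∣ p ∣
x∉p⇒∣⁅x⁆∪p∣≡1+∣p∣ {x = zero} {p = true ∷ p} x∉p = contradiction here x∉p
x∉p⇒∣⁅x⁆∪p∣≡1+∣p∣ {x = zero} {p = false ∷ p} _ = cong (suc ∘ ∣_∣) (∪-identityˡ p)
x∉p⇒∣⁅x⁆∪p∣≡1+∣p∣ {x = suc x} {p = true ∷ p} x∉p = cong suc (x∉p⇒∣⁅x⁆∪p∣≡1+∣p∣ (x∉p ∘ there))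
x∉p⇒∣⁅x⁆∪p∣≡1+∣p∣ {x = suc x} {p = false ∷ p} x∉p = x∉p⇒∣⁅x⁆∪p∣≡1+∣p∣ (x∉p ∘ there)

∣⁅x⁆∪p∣≤1+∣p∣ : ∀ (x : Fin n) p → ∣ ⁅ x ⁆ ∪ p ∣ ≤ suc ∣ p ∣
∣⁅x⁆∪p∣≤1+∣p∣ x p with x ∈? p
... | no x∉p = ≤-reflexive (x∉p⇒∣⁅x⁆∪p∣≡1+∣p∣ x∉p)
... | yes x∈p = m≤n⇒m≤1+n (p⊆q⇒∣p∣≤∣q∣ (⁅x⁆∪p⊆q x∈p ⊆-refl))

x∈p⇒1+∣p-x∣≡∣p∣ : x ∈ p → suc ∣ p - x ∣ ≡ ∣ p ∣
x∈p⇒1+∣p-x∣≡∣p∣ {x = zero} {p = true ∷ p} _ = cong (suc ∘ ∣_∣) (p─⊥≡p p)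
x∈p⇒1+∣p-x∣≡∣p∣ {x = suc x} {p = true ∷ p} (there x∈p) = cong suc (x∈p⇒1+∣p-x∣≡∣p∣ x∈p)
x∈p⇒1+∣p-x∣≡∣p∣ {x = suc x} {p = false ∷ p} (there x∈p) = x∈p⇒1+∣p-x∣≡∣p∣ x∈p

[p-x]─q≡[p─q]-x : ∀ (p q : Subset n) x → (p - x) ─ q ≡ (p ─ q) - x
[p-x]─q≡[p─q]-x p q x = p─q─r≡p─r─q p ⁅ x ⁆ q

∣p∣≤1+∣p-x∣ : ∀ (p : Subset n) x → ∣ p ∣ ≤ suc ∣ p - x ∣
∣p∣≤1+∣p-x∣ p x = ≤-trans (p⊆q⇒∣p∣≤∣q∣ p⊆⁅x⁆∪[p-x]) (∣⁅x⁆∪p∣≤1+∣p∣ x (p - x))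
  where
  p⊆⁅x⁆∪[p-x] : p ⊆ ⁅ x ⁆ ∪ (p - x)
  p⊆⁅x⁆∪[p-x] {y} y∈p with y Fin.≟ x
  ... | yes refl = p⊆p∪q (p - x) (x∈⁅x⁆ y)
  ... | no y≢x = q⊆p∪q ⁅ x ⁆ (p - x) (x∈p∧x≢y⇒x∈p-y y∈p y≢x)

x∈p⇒⁅x⁆∩p≡⁅x⁆ : x ∈ p → ⁅ x ⁆ ∩ p ≡ ⁅ x ⁆
x∈p⇒⁅x⁆∩p≡⁅x⁆ {p = true ∷ p} here = cong (true ∷_) (∩-zeroˡ p)
x∈p⇒⁅x⁆∩p≡⁅x⁆ {p = _ ∷ p} (there x∈p) = cong (false ∷_) (x∈p⇒⁅x⁆∩p≡⁅x⁆ x∈p)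

x∉p⇒⁅x⁆∩p≡∅ : x ∉ p → ⁅ x ⁆ ∩ p ≡ ∅
x∉p⇒⁅x⁆∩p≡∅ {x = zero} {p = true ∷ p} x∉p = contradiction here x∉p
x∉p⇒⁅x⁆∩p≡∅ {x = zero} {p = false ∷ p} _ = cong (false ∷_) (∩-zeroˡ p)
x∉p⇒⁅x⁆∩p≡∅ {x = suc x} {p = _ ∷ p} x∉p = cong (false ∷_) (x∉p⇒⁅x⁆∩p≡∅ (x∉p ∘ there))

x∈p⇒∣⁅x⁆∩p∣≡1 : x ∈ p → ∣ ⁅ x ⁆ ∩ p ∣ ≡ 1
x∈p⇒∣⁅x⁆∩p∣≡1 {x = x} x∈p = trans (cong ∣_∣ (x∈p⇒⁅x⁆∩p≡⁅x⁆ x∈p)) (∣⁅x⁆∣≡1 x)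

x∉p⇒∣⁅x⁆∩p∣≡0 : x ∉ p → ∣ ⁅ x ⁆ ∩ p ∣ ≡ 0
x∉p⇒∣⁅x⁆∩p∣≡0 {n} x∉p = trans (cong ∣_∣ (x∉p⇒⁅x⁆∩p≡∅ x∉p)) (∣⊥∣≡0 n)

x∉q⇒∣[⁅x⁆∪p]∩q∣≡∣p∩q∣ : ∀ p → x ∉ q → ∣ (⁅ x ⁆ ∪ p) ∩ q ∣ ≡ ∣ p ∩ q ∣
x∉q⇒∣[⁅x⁆∪p]∩q∣≡∣p∩q∣ {x = x} {q = q} p x∉q = cong ∣_∣ (begin
  (⁅ x ⁆ ∪ p) ∩ q        ≡⟨ ∩-distribʳ-∪ q ⁅ x ⁆ p ⟩
  ⁅ x ⁆ ∩ q ∪ p ∩ q      ≡⟨ cong (_∪ p ∩ q) (x∉p⇒⁅x⁆∩p≡∅ x∉q) ⟩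
  ∅ ∪ p ∩ q              ≡⟨ ∪-identityˡ (p ∩ q) ⟩
  p ∩ q                  ∎)
  where open ≡-Reasoning

x∉p⇒x∈q⇒∣[⁅x⁆∪p]∩q∣≡1+∣p∩q∣ : x ∉ p → x ∈ q → ∣ (⁅ x ⁆ ∪ p) ∩ q ∣ ≡ suc ∣ p ∩ q ∣
x∉p⇒x∈q⇒∣[⁅x⁆∪p]∩q∣≡1+∣p∩q∣ {x = x} {p = p} {q = q} x∉p x∈q = begin
  ∣ (⁅ x ⁆ ∪ p) ∩ q ∣     ≡⟨ cong ∣_∣ (∩-distribʳ-∪ q ⁅ x ⁆ p) ⟩
  ∣ ⁅ x ⁆ ∩ q ∪ p ∩ q ∣   ≡⟨ cong (λ s → ∣ s ∪ p ∩ q ∣) (x∈p⇒⁅x⁆∩p≡⁅x⁆ x∈q) ⟩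
  ∣ ⁅ x ⁆ ∪ p ∩ q ∣       ≡⟨ x∉p⇒∣⁅x⁆∪p∣≡1+∣p∣ (x∉p ∘ proj₁ ∘ x∈p∩q⁻ p q) ⟩
  suc ∣ p ∩ q ∣           ∎
  where open ≡-Reasoning

∣p++q∣≡∣p∣+∣q∣ : ∀ (p : Subset m) (q : Subset n) → ∣ p ++ q ∣ ≡ ∣ p ∣ + ∣ q ∣
∣p++q∣≡∣p∣+∣q∣ [] q = refl
∣p++q∣≡∣p∣+∣q∣ (true ∷ p) q = cong suc (∣p++q∣≡∣p∣+∣q∣ p q)
∣p++q∣≡∣p∣+∣q∣ (false ∷ p) q = ∣p++q∣≡∣p∣+∣q∣ p q

++-∩ : ∀ (p p′ : Subset m) (q q′ : Subset n) → (p ++ q) ∩ (p′ ++ q′) ≡ (p ∩ p′) ++ (q ∩ q′)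
++-∩ p p′ q q′ = zipWith-++ _ p q p′ q′

++-─ : ∀ (p p′ : Subset m) (q q′ : Subset n) → (p ++ q) ─ (p′ ++ q′) ≡ (p ─ p′) ++ (q ─ q′)
++-─ [] [] q q′ = refl
++-─ (s ∷ p) (true ∷ p′) q q′ = cong (false ∷_) (++-─ p p′ q q′)
++-─ (s ∷ p) (false ∷ p′) q q′ = cong (s ∷_) (++-─ p p′ q q′)

++-⊆ : ∀ {p p′ : Subset m} {q q′ : Subset n} → p ⊆ p′ → q ⊆ q′ → p ++ q ⊆ p′ ++ q′
++-⊆ {p = []} {[]} _ q⊆q′ = q⊆q′
++-⊆ {p = true ∷ p} {_ ∷ p′} p⊆p′ q⊆q′ here with p⊆p′ here
... | here = here
++-⊆ {p = _ ∷ p} {_ ∷ p′} p⊆p′ q⊆q′ (there x∈) = there (++-⊆ (drop-∷-⊆ p⊆p′) q⊆q′ x∈)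

++-⊆⁻ˡ : ∀ {p p′ : Subset m} {q q′ : Subset n} → p ++ q ⊆ p′ ++ q′ → p ⊆ p′
++-⊆⁻ˡ {p = true ∷ p} {_ ∷ p′} ⊆ here with ⊆ here
... | here = here
++-⊆⁻ˡ {p = _ ∷ p} {_ ∷ p′} ⊆ (there x∈) = there (++-⊆⁻ˡ (drop-∷-⊆ ⊆) x∈)

++-⊆⁻ʳ : ∀ {p p′ : Subset m} {q q′ : Subset n} → p ++ q ⊆ p′ ++ q′ → q ⊆ q′
++-⊆⁻ʳ {p = []} {[]} ⊆ = ⊆
++-⊆⁻ʳ {p = _ ∷ p} {_ ∷ p′} ⊆ = ++-⊆⁻ʳ {p = p} {p′} (drop-∷-⊆ ⊆)

∣tabulate∣≡sum : ∀ (f : Fin n → Bool) → ∣ tabulate f ∣ ≡ sum (λ i → if f i then 1 else 0)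
∣tabulate∣≡sum {zero} f = refl
∣tabulate∣≡sum {suc n} f with f zero
... | true = cong suc (∣tabulate∣≡sum (f ∘ suc))
... | false = ∣tabulate∣≡sum (f ∘ suc)

∣tabulate∘π∣≡∣tabulate∣ : ∀ (f : Fin n → Bool) (π : Permutation m n) →
                           ∣ tabulate (f ∘ (π ⟨$⟩ʳ_)) ∣ ≡ ∣ tabulate f ∣
∣tabulate∘π∣≡∣tabulate∣ f π = begin
  ∣ tabulate (f ∘ (π ⟨$⟩ʳ_)) ∣                        ≡⟨ ∣tabulate∣≡sum (f ∘ (π ⟨$⟩ʳ_)) ⟩
  sum (λ i → if f (π ⟨$⟩ʳ i) then 1 else 0)           ≡⟨ sum-permute (λ i → if f i then 1 else 0) π ⟨
  sum (λ i → if f i then 1 else 0)                    ≡⟨ ∣tabulate∣≡sum f ⟨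
  ∣ tabulate f ∣                                      ∎
  where open ≡-Reasoning

module _ (π : Permutation m n) where

  y∈image⁻ : ∀ {X} → y ∈ image π X → π ⟨$⟩ˡ y ∈ X
  y∈image⁻ {X = X} y∈ = lookup⇒[]= _ X (x∈tabulate⁻ y∈)

  y∈image⁺ : ∀ {X} → π ⟨$⟩ˡ y ∈ X → y ∈ image π X
  y∈image⁺ y∈ = x∈tabulate⁺ ([]=⇒lookup y∈)

  x∈X⇒πx∈image : ∀ {X} → x ∈ X → π ⟨$⟩ʳ x ∈ image π X
  x∈X⇒πx∈image {X = X} x∈X = y∈image⁺ (subst (_∈ X) (sym (inverseˡ π)) x∈X)

  ∣image∣ : ∀ X → ∣ image π X ∣ ≡ ∣ X ∣
  ∣image∣ X = trans (∣tabulate∘π∣≡∣tabulate∣ (lookup X) (flip π)) (cong ∣_∣ (tabulate∘lookup X))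

  image-⊆ : ∀ {X Y} → X ⊆ Y → image π X ⊆ image π Y
  image-⊆ X⊆Y = y∈image⁺ ∘ X⊆Y ∘ y∈image⁻

  image-zipWith : ∀ (f : Bool → Bool → Bool) X Y →
                  image π (zipWith f X Y) ≡ zipWith f (image π X) (image π Y)
  image-zipWith f X Y = begin
    tabulate (λ y → lookup (zipWith f X Y) (π ⟨$⟩ˡ y))
      ≡⟨ tabulate-cong (λ y → lookup-zipWith f (π ⟨$⟩ˡ y) X Y) ⟩
    tabulate (λ y → f (lookup X (π ⟨$⟩ˡ y)) (lookup Y (π ⟨$⟩ˡ y)))
      ≡⟨ tabulate-cong lookup-image ⟨
    tabulate (lookup (zipWith f (image π X) (image π Y)))
      ≡⟨ tabulate∘lookup _ ⟩
    zipWith f (image π X) (image π Y)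
      ∎
    where
    open ≡-Reasoning
    lookup-image : ∀ y → lookup (zipWith f (image π X) (image π Y)) y ≡
                         f (lookup X (π ⟨$⟩ˡ y)) (lookup Y (π ⟨$⟩ˡ y))
    lookup-image y = trans (lookup-zipWith f y (image π X) (image π Y))
      (cong₂ f (lookup∘tabulate (lookup X ∘ (π ⟨$⟩ˡ_)) y) (lookup∘tabulate (lookup Y ∘ (π ⟨$⟩ˡ_)) y))

  image-⁅⁆ : ∀ y → image π ⁅ π ⟨$⟩ˡ y ⁆ ≡ ⁅ y ⁆
  image-⁅⁆ y = ⊆-antisym
    (λ {z} z∈ → subst (_∈ ⁅ y ⁆) (π⁻¹-injective (sym (x∈⁅y⁆⇒x≡y _ (y∈image⁻ z∈)))) (x∈⁅x⁆ y))
    (λ z∈ → y∈image⁺ (subst (_∈ ⁅ π ⟨$⟩ˡ y ⁆) (cong (π ⟨$⟩ˡ_) (sym (x∈⁅y⁆⇒x≡y y z∈))) (x∈⁅x⁆ _)))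
    where
    π⁻¹-injective : ∀ {z} → π ⟨$⟩ˡ y ≡ π ⟨$⟩ˡ z → y ≡ z
    π⁻¹-injective {z} eq = trans (sym (inverseʳ π)) (trans (cong (π ⟨$⟩ʳ_) eq) (inverseʳ π))

  image-─ : ∀ X Y → image π (X ─ Y) ≡ image π X ─ image π Y
  image-─ X Y = ⊆-antisym
    (λ y∈ → let y∈X , y∉Y = x∈p─q⁻ X Y (y∈image⁻ {X = X ─ Y} y∈) in
            x∈p∧x∉q⇒x∈p─q (y∈image⁺ y∈X) (y∉Y ∘ y∈image⁻))
    (λ y∈ → let y∈X , y∉Y = x∈p─q⁻ (image π X) (image π Y) y∈ in
            y∈image⁺ {X = X ─ Y} (x∈p∧x∉q⇒x∈p─q (y∈image⁻ y∈X) (y∉Y ∘ y∈image⁺)))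

image-flip-image : ∀ (π : Permutation m n) X → image (flip π) (image π X) ≡ X
image-flip-image π X = ⊆-antisym
  (λ x∈ → subst (_∈ X) (inverseˡ π) (y∈image⁻ π (y∈image⁻ (flip π) x∈)))
  (λ x∈ → y∈image⁺ (flip π) (x∈X⇒πx∈image π x∈))

-- Ranks, bases and circuits

module _ {m : ℕ} (M : Matroid m) where
  open Matroid M

  independent? : ∀ X → Dec (Independent M X)
  independent? X = indep X ≟ᵇ true

  HasRank-unique : ∀ {S k k′} → HasRank M S k → HasRank M S k′ → k ≡ k′
  HasRank-unique ((I , I⊆S , I-ind , ∣I∣≡k) , rank-bound) ((I′ , I′⊆S , I′-ind , ∣I′∣≡k′) , rank-bound′) =
    ≤-antisym (subst (_≤ _) ∣I∣≡k (rank-bound′ I I⊆S I-ind))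
              (subst (_≤ _) ∣I′∣≡k′ (rank-bound I′ I′⊆S I′-ind))

  HasRank⇒≤∣∣ : ∀ {S k} → HasRank M S k → k ≤ ∣ S ∣
  HasRank⇒≤∣∣ ((I , I⊆S , _ , ∣I∣≡k) , _) = subst (_≤ _) ∣I∣≡k (p⊆q⇒∣p∣≤∣q∣ I⊆S)

  HasRank-mono : ∀ {Z Z′ k k′} → Z ⊆ Z′ → HasRank M Z k → HasRank M Z′ k′ → k ≤ k′
  HasRank-mono Z⊆Z′ ((I , I⊆Z , I-ind , ∣I∣≡k) , _) (_ , rank-bound′) =
    subst (_≤ _) ∣I∣≡k (rank-bound′ I (Z⊆Z′ ∘ I⊆Z) I-ind)

  IsCyclic∧Independent⇒Empty : ∀ {Z} → IsCyclic M Z → Independent M Z → Empty Z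
  IsCyclic∧Independent⇒Empty {Z} Z-cyclic Z-ind (x , x∈Z) =
    let C , (C-dep , _) , _ , C⊆Z = Z-cyclic x x∈Z in C-dep (indep-⊆ Z C C⊆Z Z-ind)

  IsBasis : Subset m → Subset m → Set
  IsBasis S J = J ⊆ S × Independent M J × (∀ e → e ∈ S → e ∉ J → ¬ Independent M (⁅ e ⁆ ∪ J))

  IsBasis⇒HasRank : ∀ {S J} → IsBasis S J → HasRank M S ∣ J ∣
  IsBasis⇒HasRank {S} {J} (J⊆S , J-ind , J-maximal) = (J , J⊆S , J-ind , refl) , ≤∣J∣
    where
    ≤∣J∣ : ∀ I → I ⊆ S → Independent M I → ∣ I ∣ ≤ ∣ J ∣
    ≤∣J∣ I I⊆S I-ind with ∣ I ∣ ≤? ∣ J ∣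
    ... | yes ∣I∣≤∣J∣ = ∣I∣≤∣J∣
    ... | no ∣I∣≰∣J∣ with augment J I J-ind I-ind (≰⇒> ∣I∣≰∣J∣)
    ...   | e , e∈I , e∉J , J+e-ind = contradiction J+e-ind (J-maximal e (I⊆S e∈I) e∉J)

  extend-to-basis′ : ∀ k S I → I ⊆ S → Independent M I → ∣ S ∣ ≤ k + ∣ I ∣ →
                     ∃ λ J → I ⊆ J × IsBasis S J
  extend-to-basis′ k S I I⊆S I-ind ∣S∣≤k+∣I∣
    with Fin.any? (λ e → e ∈? S ×-dec ¬? (e ∈? I) ×-dec independent? (⁅ e ⁆ ∪ I))
  ... | no no-extension =
    I , ⊆-refl , I⊆S , I-ind , λ e e∈S e∉I I+e-ind → no-extension (e , e∈S , e∉I , I+e-ind)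
  extend-to-basis′ zero S I I⊆S I-ind ∣S∣≤∣I∣ | yes (e , e∈S , e∉I , _) =
    contradiction (p⊆q⇒∣q∣≤∣p∣⇒q⊆p I⊆S ∣S∣≤∣I∣ e∈S) e∉I
  extend-to-basis′ (suc k) S I I⊆S I-ind ∣S∣≤1+k+∣I∣ | yes (e , e∈S , e∉I , I+e-ind)
    with extend-to-basis′ k S (⁅ e ⁆ ∪ I) (⁅x⁆∪p⊆q e∈S I⊆S) I+e-ind
           (subst (∣ S ∣ ≤_) (trans (sym (+-suc k ∣ I ∣)) (cong (k +_) (sym (x∉p⇒∣⁅x⁆∪p∣≡1+∣p∣ e∉I))))
                  ∣S∣≤1+k+∣I∣)
  ... | J , I+e⊆J , J-basis = J , I+e⊆J ∘ q⊆p∪q ⁅ e ⁆ I , J-basis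

  extend-to-basis : ∀ S I → I ⊆ S → Independent M I → ∃ λ J → I ⊆ J × IsBasis S J
  extend-to-basis S I I⊆S I-ind = extend-to-basis′ ∣ S ∣ S I I⊆S I-ind (m≤m+n ∣ S ∣ ∣ I ∣)

  rank-exists : ∀ S → ∃ λ k → HasRank M S k
  rank-exists S =
    let J , _ , J-basis = extend-to-basis S ∅ (⊆-min S) indep-∅ in ∣ J ∣ , IsBasis⇒HasRank J-basis

  dependent⇒⊇circuit′ : ∀ k D → ∣ D ∣ ≡ k → ¬ Independent M D → ∃ λ C → IsCircuit M C × C ⊆ D
  dependent⇒⊇circuit′ k D ∣D∣≡k D-dep
    with Fin.all? (λ x → x ∈? D →-dec independent? (D - x))
  ... | yes minimal = D , (D-dep , minimal) , λ x∈ → x∈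
  ... | no ¬minimal with Fin.¬∀⟶∃¬ m _ (λ x → x ∈? D →-dec independent? (D - x)) ¬minimal
  ...   | x , ¬[x∈D→D-x-ind] with x ∈? D | independent? (D - x)
  ...     | no x∉D | _ = contradiction (λ x∈D → contradiction x∈D x∉D) ¬[x∈D→D-x-ind]
  ...     | _ | yes D-x-ind = contradiction (λ _ → D-x-ind) ¬[x∈D→D-x-ind]
  dependent⇒⊇circuit′ zero D ∣D∣≡0 D-dep | no _ | x , _ | yes x∈D | no _ =
    contradiction ∣D∣≡0 (>⇒≢ (x∈p⇒0<∣p∣ x∈D))
  dependent⇒⊇circuit′ (suc k) D ∣D∣≡1+k D-dep | no _ | x , _ | yes x∈D | no D-x-dep
    with dependent⇒⊇circuit′ k (D - x) (suc-injective (trans (x∈p⇒1+∣p-x∣≡∣p∣ x∈D) ∣D∣≡1+k)) D-x-dep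
  ... | C , C-circuit , C⊆D-x = C , C-circuit , proj₁ ∘ x∈p-y⁻ D ∘ C⊆D-x

  dependent⇒⊇circuit : ∀ D → ¬ Independent M D → ∃ λ C → IsCircuit M C × C ⊆ D
  dependent⇒⊇circuit D = dependent⇒⊇circuit′ ∣ D ∣ D refl

  same-rank-without⇒circuit : ∀ {Z e k} → e ∈ Z → HasRank M (Z - e) k → HasRank M Z k →
                    ∃ λ C → IsCircuit M C × e ∈ C × C ⊆ Z
  same-rank-without⇒circuit {Z} {e} {k} e∈Z ((B , B⊆Z-e , B-ind , ∣B∣≡k) , _) (_ , rank-bound)
    with independent? (⁅ e ⁆ ∪ B)
  ... | yes B+e-ind = contradiction (rank-bound _ B+e⊆Z B+e-ind) (<⇒≱ (≤-reflexive ∣B+e∣≡1+k))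
    where
    e∉B : e ∉ B
    e∉B e∈B = proj₂ (x∈p-y⁻ Z (B⊆Z-e e∈B)) refl
    B+e⊆Z : ⁅ e ⁆ ∪ B ⊆ Z
    B+e⊆Z = ⁅x⁆∪p⊆q e∈Z (proj₁ ∘ x∈p-y⁻ Z ∘ B⊆Z-e)
    ∣B+e∣≡1+k : suc k ≡ ∣ ⁅ e ⁆ ∪ B ∣
    ∣B+e∣≡1+k = sym (trans (x∉p⇒∣⁅x⁆∪p∣≡1+∣p∣ e∉B) (cong suc ∣B∣≡k))
  ... | no B+e-dep with dependent⇒⊇circuit (⁅ e ⁆ ∪ B) B+e-dep
  ...   | C , C-circuit , C⊆B+e with e ∈? C
  ...     | yes e∈C = C , C-circuit , e∈C , ⁅x⁆∪p⊆q e∈Z (proj₁ ∘ x∈p-y⁻ Z ∘ B⊆Z-e) ∘ C⊆B+e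
  ...     | no e∉C = contradiction (indep-⊆ B C C⊆B B-ind) (proj₁ C-circuit)
    where
    C⊆B : C ⊆ B
    C⊆B {x} x∈C with x∈p∪q⁻ ⁅ e ⁆ B (C⊆B+e x∈C)
    ... | inj₁ x∈⁅e⁆ rewrite x∈⁅y⁆⇒x≡y e x∈⁅e⁆ = contradiction x∈C e∉C
    ... | inj₂ x∈B = x∈B

  circuit⇒same-rank-without : ∀ {C Z e k} → IsCircuit M C → e ∈ C → C ⊆ Z → HasRank M Z k →
                                ∃ λ J → J ⊆ Z - e × Independent M J × ∣ J ∣ ≡ k
  circuit⇒same-rank-without {C} {Z} {e} {k} (C-dep , C-minimal) e∈C C⊆Z Z-rank
    with extend-to-basis (Z - e) (C - e) C-e⊆Z-e (C-minimal e e∈C)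
    where
    C-e⊆Z-e : C - e ⊆ Z - e
    C-e⊆Z-e x∈ = let x∈C , x≢e = x∈p-y⁻ C x∈ in x∈p∧x≢y⇒x∈p-y (C⊆Z x∈C) x≢e
  ... | J , C-e⊆J , J⊆Z-e , J-ind , J-maximal =
    J , J⊆Z-e , J-ind ,
    HasRank-unique (IsBasis⇒HasRank (proj₁ ∘ x∈p-y⁻ Z ∘ J⊆Z-e , J-ind , J-maximalInZ)) Z-rank
    where
    J-maximalInZ : ∀ x → x ∈ Z → x ∉ J → ¬ Independent M (⁅ x ⁆ ∪ J)
    J-maximalInZ x x∈Z x∉J with x Fin.≟ e
    ... | no x≢e = J-maximal x (x∈p∧x≢y⇒x∈p-y x∈Z x≢e) x∉J
    ... | yes refl = C-dep ∘ indep-⊆ _ C C⊆J+x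
      where
      C⊆J+x : C ⊆ ⁅ x ⁆ ∪ J
      C⊆J+x {y} y∈C with y Fin.≟ x
      ... | yes refl = p⊆p∪q J (x∈⁅x⁆ y)
      ... | no y≢x = q⊆p∪q ⁅ x ⁆ J (C-e⊆J (x∈p∧x≢y⇒x∈p-y y∈C y≢x))

  loopless⇒∅-isCyclicFlat : (∀ e → Independent M ⁅ e ⁆) → IsCyclicFlat M ∅
  loopless⇒∅-isCyclicFlat loopless = ∅-flat , λ e e∈∅ → contradiction e∈∅ ∉⊥
    where
    ∅-flat : IsFlat M ∅
    ∅-flat e _ k ∅-rank ⁅e⁆-rank = <⇒≱ 0<k (≤-trans (HasRank⇒≤∣∣ ∅-rank) (≤-reflexive (∣⊥∣≡0 m)))
      where
      0<k : 0 < k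
      0<k = ≤-trans (≤-reflexive (sym (trans (cong ∣_∣ (∪-identityʳ ⁅ e ⁆)) (∣⁅x⁆∣≡1 e))))
                    (proj₂ ⁅e⁆-rank _ ⊆-refl (subst (Independent M) (sym (∪-identityʳ ⁅ e ⁆)) (loopless e)))

-- Transport along matroid isomorphisms

module _ {m n : ℕ} {M : Matroid m} {N : Matroid n} where

  MatroidIso-sym : MatroidIso M N → MatroidIso N M
  MatroidIso-sym (π , π-indep) = flip π , λ Y →
    trans (sym (π-indep (image (flip π) Y))) (cong (Matroid.indep N) (image-flip-image (flip π) Y))

  module _ (iso : MatroidIso M N) where
    open Σ iso renaming (proj₁ to π; proj₂ to π-indep)

    image-independent : ∀ {X} → Independent M X → Independent N (image π X)
    image-independent {X} = trans (π-indep X)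

    image-independent⁻ : ∀ {X} → Independent N (image π X) → Independent M X
    image-independent⁻ {X} = trans (sym (π-indep X))

    image-HasRank⁻ : ∀ {S k} → HasRank N (image π S) k → HasRank M S k
    image-HasRank⁻ {S} {k} ((I , I⊆πS , I-ind , ∣I∣≡k) , rank-bound) =
      (image (flip π) I , π⁻¹I⊆S , π⁻¹I-ind , trans (∣image∣ (flip π) I) ∣I∣≡k) , ≤k
      where
      π⁻¹I⊆S : image (flip π) I ⊆ S
      π⁻¹I⊆S x∈ = subst (_∈ S) (inverseˡ π) (y∈image⁻ π (I⊆πS (y∈image⁻ (flip π) x∈)))
      π⁻¹I-ind : Independent M (image (flip π) I)
      π⁻¹I-ind = image-independent⁻ (subst (Independent N) (sym (image-flip-image (flip π) I)) I-ind)
      ≤k : ∀ I′ → I′ ⊆ S → Independent M I′ → ∣ I′ ∣ ≤ k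
      ≤k I′ I′⊆S I′-ind = subst (_≤ k) (∣image∣ π I′) (rank-bound _ (image-⊆ π I′⊆S) (image-independent I′-ind))

    image-isCircuit : ∀ {C} → IsCircuit M C → IsCircuit N (image π C)
    image-isCircuit {C} (C-dep , C-minimal) = C-dep ∘ image-independent⁻ , λ e e∈πC →
      subst (Independent N) (πC-e≡πC-πe e) (image-independent (C-minimal _ (y∈image⁻ π e∈πC)))
      where
      πC-e≡πC-πe : ∀ e → image π (C - (π ⟨$⟩ˡ e)) ≡ image π C - e
      πC-e≡πC-πe e = trans (image-─ π C _) (cong (image π C ─_) (image-⁅⁆ π e))

    image-isCyclicFlat : ∀ {Z} → IsCyclicFlat M Z → IsCyclicFlat N (image π Z)
    image-isCyclicFlat {Z} (Z-flat , Z-cyclic) = πZ-flat , πZ-cyclic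
      where
      πZ+e≡π[Z+π⁻¹e] : ∀ e → ⁅ e ⁆ ∪ image π Z ≡ image π (⁅ π ⟨$⟩ˡ e ⁆ ∪ Z)
      πZ+e≡π[Z+π⁻¹e] e = sym (trans (image-zipWith π _ ⁅ π ⟨$⟩ˡ e ⁆ Z)
                                    (cong (_∪ image π Z) (image-⁅⁆ π e)))
      πZ-flat : IsFlat N (image π Z)
      πZ-flat e e∉πZ k πZ-rank πZ+e-rank =
        Z-flat (π ⟨$⟩ˡ e) (e∉πZ ∘ y∈image⁺ π) k (image-HasRank⁻ πZ-rank)
               (image-HasRank⁻ (subst (λ T → HasRank N T k) (πZ+e≡π[Z+π⁻¹e] e) πZ+e-rank))
      πZ-cyclic : IsCyclic N (image π Z)
      πZ-cyclic e e∈πZ =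
        let C , C-circuit , π⁻¹e∈C , C⊆Z = Z-cyclic (π ⟨$⟩ˡ e) (y∈image⁻ π e∈πZ)
        in image π C , image-isCircuit C-circuit , y∈image⁺ π π⁻¹e∈C , image-⊆ π C⊆Z

-- Matroids given by capacities on a family of sets

module FromCapacities {m : ℕ} {K : Set} (S : K → Subset m) (cap : K → ℕ)
                      (ks : List K) (ks-complete : ∀ k → k ∈ˡ ks) where

  WithinCapacity : Subset m → Set
  WithinCapacity I = ∀ k → ∣ I ∩ S k ∣ ≤ cap k

  Tight : Subset m → K → Set
  Tight I k = ∣ I ∩ S k ∣ ≡ cap k

  withinCapacity? : ∀ I → Dec (WithinCapacity I)
  withinCapacity? I =
    Dec.map′ (λ all k → All.lookup all (ks-complete k)) (λ within → All.tabulate λ {k} _ → within k)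
             (All.all? (λ k → ∣ I ∩ S k ∣ ≤? cap k) ks)

  indep : Subset m → Bool
  indep I = does (withinCapacity? I)

  within⇒indep : ∀ I → WithinCapacity I → indep I ≡ true
  within⇒indep I = Dec.dec-true (withinCapacity? I)

  indep⇒within : ∀ I → indep I ≡ true → WithinCapacity I
  indep⇒within I indep≡true = invert (subst (Reflects _) indep≡true (proof (withinCapacity? I)))

  ¬within⇒overfull : ∀ {I} → ¬ WithinCapacity I → ∃ λ k → cap k < ∣ I ∩ S k ∣
  ¬within⇒overfull {I} ¬within =
    let k , ∣I∩Sk∣≰cap = satisfied (¬All⇒Any¬ (λ k → ∣ I ∩ S k ∣ ≤? cap k) ks
                                              (λ all → ¬within λ k → All.lookup all (ks-complete k)))
    in k , ≰⇒> ∣I∩Sk∣≰cap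

  ∅-within : WithinCapacity ∅
  ∅-within k = ≤-trans (≤-reflexive (trans (cong ∣_∣ (∩-zeroˡ (S k))) (∣⊥∣≡0 m))) z≤n

  within-⊆ : ∀ {I J} → J ⊆ I → WithinCapacity I → WithinCapacity J
  within-⊆ {I} {J} J⊆I I-within k = ≤-trans (p⊆q⇒∣p∣≤∣q∣ J∩Sk⊆I∩Sk) (I-within k)
    where
    J∩Sk⊆I∩Sk : J ∩ S k ⊆ I ∩ S k
    J∩Sk⊆I∩Sk x∈ = let x∈J , x∈Sk = x∈p∩q⁻ J (S k) x∈ in x∈p∩q⁺ (J⊆I x∈J , x∈Sk)

  ⁅e⁆∪I-within : ∀ {I e} → WithinCapacity I → e ∉ I → (∀ k → Tight I k → e ∉ S k) →
                 WithinCapacity (⁅ e ⁆ ∪ I)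
  ⁅e⁆∪I-within {I} {e} I-within e∉I e-avoids-tight k with e ∈? S k
  ... | no e∉Sk = subst (_≤ cap k) (sym (x∉q⇒∣[⁅x⁆∪p]∩q∣≡∣p∩q∣ I e∉Sk)) (I-within k)
  ... | yes e∈Sk = subst (_≤ cap k) (sym (x∉p⇒x∈q⇒∣[⁅x⁆∪p]∩q∣≡1+∣p∩q∣ e∉I e∈Sk))
                         (≤∧≢⇒< (I-within k) (λ tight → e-avoids-tight k tight e∈Sk))

  ¬⁅e⁆∪I-within⇒tight : ∀ {I e} → WithinCapacity I → e ∉ I → ¬ WithinCapacity (⁅ e ⁆ ∪ I) →
                        ∃ λ k → Tight I k × e ∈ S k
  ¬⁅e⁆∪I-within⇒tight {I} {e} I-within e∉I ¬within with ¬within⇒overfull {⁅ e ⁆ ∪ I} ¬within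
  ... | k , overfull with e ∈? S k
  ...   | no e∉Sk =
    contradiction (subst (_≤ cap k) (sym (x∉q⇒∣[⁅x⁆∪p]∩q∣≡∣p∩q∣ I e∉Sk)) (I-within k)) (<⇒≱ overfull)
  ...   | yes e∈Sk = k , ≤-antisym (I-within k) cap≤∣I∩Sk∣ , e∈Sk
    where
    cap≤∣I∩Sk∣ : cap k ≤ ∣ I ∩ S k ∣
    cap≤∣I∩Sk∣ = s≤s⁻¹ (≤-trans overfull (≤-reflexive (x∉p⇒x∈q⇒∣[⁅x⁆∪p]∩q∣≡1+∣p∩q∣ e∉I e∈Sk)))

  ∣I∣≤cap+∣W─S∣ : ∀ {I W} g → I ─ S g ⊆ W → WithinCapacity I → ∣ I ∣ ≤ cap g + ∣ W ─ S g ∣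
  ∣I∣≤cap+∣W─S∣ {I} {W} g I─Sg⊆W I-within = begin
    ∣ I ∣                          ≡⟨ ∣p∣≡∣p∩q∣+∣p─q∣ I (S g) ⟩
    ∣ I ∩ S g ∣ + ∣ I ─ S g ∣      ≤⟨ +-mono-≤ (I-within g) (p⊆q⇒∣p∣≤∣q∣ I─Sg⊆W─Sg) ⟩
    cap g + ∣ W ─ S g ∣            ∎
    where
    open ≤-Reasoning
    I─Sg⊆W─Sg : I ─ S g ⊆ W ─ S g
    I─Sg⊆W─Sg x∈ = x∈p∧x∉q⇒x∈p─q (I─Sg⊆W x∈) (proj₂ (x∈p─q⁻ I (S g) x∈))

  Tight⇒∣I∣≡cap+∣I─S∣ : ∀ {I g} → Tight I g → ∣ I ∣ ≡ cap g + ∣ I ─ S g ∣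
  Tight⇒∣I∣≡cap+∣I─S∣ {I} {g} tight = trans (∣p∣≡∣p∩q∣+∣p─q∣ I (S g)) (cong (_+ ∣ I ─ S g ∣) tight)

  Above : K → K → Set
  Above f g = S f ⊆ S g × cap f ≤ cap g × (S g ⊆ S f ⊎ cap f < cap g)

  Slack : K → K → Set
  Slack f g = cap f < cap g + ∣ S f ─ S g ∣

  record CyclicFlatCondition (f : K) : Set where
    field
      cap<∣S∣        : cap f < ∣ S f ∣
      above-or-slack : ∀ g → Above f g ⊎ Slack f g

  -- Directedness gives each independent X a largest tight member S u. To augment X from a larger Y,
  -- take an element of Y ─ S u outside X: one exists since Y has at most as many elements as X in S u.
  module Directed (tight-directed : ∀ I → WithinCapacity I → ∀ k k′ → Tight I k → Tight I k′ →
                                    ∃ λ w → Tight I w × S k ⊆ S w × S k′ ⊆ S w) where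

    TightCeiling : Subset m → Set
    TightCeiling I = (∀ k → ¬ Tight I k) ⊎ ∃ λ u → Tight I u × (∀ k → Tight I k → S k ⊆ S u)

    tightCeiling : ∀ {I} → WithinCapacity I → TightCeiling I
    tightCeiling {I} I-within with ceilingAmong ks
      where
      ceilingAmong : ∀ l → (∀ k → k ∈ˡ l → ¬ Tight I k) ⊎
                           ∃ λ u → Tight I u × (∀ k → k ∈ˡ l → Tight I k → S k ⊆ S u)
      ceilingAmong [] = inj₁ λ _ ()
      ceilingAmong (k ∷ l) with ∣ I ∩ S k ∣ ≟ cap k | ceilingAmong l
      ... | no ¬tight | inj₁ none = inj₁ λ { _ (here refl) → ¬tight ; k′ (there k′∈l) → none k′ k′∈l }
      ... | no ¬tight | inj₂ (u , u-tight , u-ceiling) =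
        inj₂ (u , u-tight , λ { _ (here refl) tight → contradiction tight ¬tight
                              ; k′ (there k′∈l) → u-ceiling k′ k′∈l })
      ... | yes tight | inj₁ none =
        inj₂ (k , tight , λ { _ (here refl) _ → ⊆-refl
                            ; k′ (there k′∈l) tight′ → contradiction tight′ (none k′ k′∈l) })
      ... | yes tight | inj₂ (u , u-tight , u-ceiling) =
        let w , w-tight , Su⊆Sw , Sk⊆Sw = tight-directed I I-within u k u-tight tight
        in inj₂ (w , w-tight , λ { _ (here refl) _ → Sk⊆Sw
                                 ; k′ (there k′∈l) tight′ → Su⊆Sw ∘ u-ceiling k′ k′∈l tight′ })
    ... | inj₁ none = inj₁ λ k → none k (ks-complete k)
    ... | inj₂ (u , u-tight , u-ceiling) = inj₂ (u , u-tight , λ k → u-ceiling k (ks-complete k))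

    Y─Su⊈X : ∀ {X Y u} → WithinCapacity Y → Tight X u → ∣ X ∣ < ∣ Y ∣ → ¬ Y ─ S u ⊆ X
    Y─Su⊈X {X} {Y} {u} Y-within u-tight ∣X∣<∣Y∣ Y─Su⊆X = <⇒≱ ∣X∣<∣Y∣ (begin
      ∣ Y ∣                  ≤⟨ ∣I∣≤cap+∣W─S∣ u Y─Su⊆X Y-within ⟩
      cap u + ∣ X ─ S u ∣    ≡⟨ Tight⇒∣I∣≡cap+∣I─S∣ {X} u-tight ⟨
      ∣ X ∣                  ∎)
      where open ≤-Reasoning

    augment : ∀ X Y → indep X ≡ true → indep Y ≡ true → ∣ X ∣ < ∣ Y ∣ →
              ∃ λ e → e ∈ Y × e ∉ X × indep (⁅ e ⁆ ∪ X) ≡ true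
    augment X Y X-ind Y-ind ∣X∣<∣Y∣ with tightCeiling {X} (indep⇒within X X-ind)
    ... | inj₁ none =
      let e , e∈Y , e∉X = p⊈q⇒∃∈p∉q (<⇒≱ ∣X∣<∣Y∣ ∘ p⊆q⇒∣p∣≤∣q∣)
      in e , e∈Y , e∉X ,
         within⇒indep (⁅ e ⁆ ∪ X) (⁅e⁆∪I-within {X} (indep⇒within X X-ind) e∉X λ k tight _ → none k tight)
    ... | inj₂ (u , u-tight , u-ceiling) =
      let e , e∈Y─Su , e∉X = p⊈q⇒∃∈p∉q (Y─Su⊈X {X} {Y} (indep⇒within Y Y-ind) u-tight ∣X∣<∣Y∣)
          e∈Y , e∉Su = x∈p─q⁻ Y (S u) e∈Y─Su
      in e , e∈Y , e∉X ,
         within⇒indep (⁅ e ⁆ ∪ X)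
           (⁅e⁆∪I-within {X} (indep⇒within X X-ind) e∉X λ k tight → e∉Su ∘ u-ceiling k tight)

    matroid : Matroid m
    matroid = record
      { indep   = indep
      ; indep-∅ = within⇒indep ∅ ∅-within
      ; indep-⊆ = λ X Y Y⊆X → within⇒indep Y ∘ within-⊆ Y⊆X ∘ indep⇒within X
      ; augment = augment
      }

    -- The next three lemmas say that r(W) = min (∣ W ∣ , min_g (cap g + ∣ W ─ S g ∣)).
    HasRank⇒≤cap+∣─∣ : ∀ {W k} → HasRank matroid W k → ∀ g → k ≤ cap g + ∣ W ─ S g ∣
    HasRank⇒≤cap+∣─∣ ((I , I⊆W , I-ind , ∣I∣≡k) , _) g =
      subst (_≤ _) ∣I∣≡k (∣I∣≤cap+∣W─S∣ g (I⊆W ∘ p─q⊆p I (S g)) (indep⇒within I I-ind))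

    rank-attained : ∀ Z → ∃ λ k → HasRank matroid Z k × (k ≡ ∣ Z ∣ ⊎ ∃ λ g → k ≡ cap g + ∣ Z ─ S g ∣)
    rank-attained Z with extend-to-basis matroid Z ∅ (⊆-min Z) (within⇒indep ∅ ∅-within)
    ... | J , _ , J-basis@(J⊆Z , J-ind , J-maximal) = ∣ J ∣ , IsBasis⇒HasRank matroid J-basis , value
      where
      J-within : WithinCapacity J
      J-within = indep⇒within J J-ind
      ∈J-unless-tight : ∀ {x} → x ∈ Z → (∀ k → Tight J k → x ∉ S k) → x ∈ J
      ∈J-unless-tight {x} x∈Z x-avoids-tight with x ∈? J
      ... | yes x∈J = x∈J
      ... | no x∉J =
        let k , tight , x∈Sk =
              ¬⁅e⁆∪I-within⇒tight {J} J-within x∉J (J-maximal x x∈Z x∉J ∘ within⇒indep (⁅ x ⁆ ∪ J))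
        in contradiction x∈Sk (x-avoids-tight k tight)
      value : ∣ J ∣ ≡ ∣ Z ∣ ⊎ ∃ λ g → ∣ J ∣ ≡ cap g + ∣ Z ─ S g ∣
      value with tightCeiling {J} J-within
      ... | inj₁ none = inj₁ (cong ∣_∣ (⊆-antisym J⊆Z λ x∈Z → ∈J-unless-tight x∈Z λ k tight _ → none k tight))
      ... | inj₂ (u , u-tight , u-ceiling) =
        inj₂ (u , trans (Tight⇒∣I∣≡cap+∣I─S∣ {J} u-tight)
                        (cong (λ s → cap u + ∣ s ∣) (⊆-antisym (p⊆q⇒p─r⊆q─r J⊆Z) Z─Su⊆J─Su)))
        where
        Z─Su⊆J─Su : Z ─ S u ⊆ J ─ S u
        Z─Su⊆J─Su x∈ = let x∈Z , x∉Su = x∈p─q⁻ Z (S u) x∈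
                       in x∈p∧x∉q⇒x∈p─q (∈J-unless-tight x∈Z λ k tight → x∉Su ∘ u-ceiling k tight) x∉Su

    ≤HasRank : ∀ {W c k} → c ≤ ∣ W ∣ → (∀ g → c ≤ cap g + ∣ W ─ S g ∣) → HasRank matroid W k → c ≤ k
    ≤HasRank {W} {c} c≤∣W∣ c≤cap+∣W─S∣ W-rank =
      let k′ , W-rank′ , value = rank-attained W
      in subst (c ≤_) (HasRank-unique matroid W-rank′ W-rank)
           ([ (λ k′≡∣W∣ → subst (c ≤_) (sym k′≡∣W∣) c≤∣W∣)
            , (λ (g , k′≡) → subst (c ≤_) (sym k′≡) (c≤cap+∣W─S∣ g)) ]′ value)

    IsCyclic⇒⊆S : ∀ {Z k g} → IsCyclic matroid Z → HasRank matroid Z k → k ≡ cap g + ∣ Z ─ S g ∣ → Z ⊆ S g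
    IsCyclic⇒⊆S {Z} {k} {g} Z-cyclic Z-rank k≡cap+∣Z─S∣ {x} x∈Z with x ∈? S g
    ... | yes x∈Sg = x∈Sg
    ... | no x∉Sg =
      let C , C-circuit , x∈C , C⊆Z = Z-cyclic x x∈Z
          J , J⊆Z-x , J-ind , ∣J∣≡k = circuit⇒same-rank-without matroid C-circuit x∈C C⊆Z Z-rank
      in contradiction (begin-strict
        k                              ≡⟨ ∣J∣≡k ⟨
        ∣ J ∣                          ≤⟨ ∣I∣≤cap+∣W─S∣ g (J⊆Z-x ∘ p─q⊆p J (S g)) (indep⇒within J J-ind) ⟩
        cap g + ∣ (Z - x) ─ S g ∣      ≡⟨ cong (λ s → cap g + ∣ s ∣) ([p-x]─q≡[p─q]-x Z (S g) x) ⟩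
        cap g + ∣ (Z ─ S g) - x ∣      <⟨ +-monoʳ-< (cap g) (x∈p⇒∣p-x∣<∣p∣ (x∈p∧x∉q⇒x∈p─q x∈Z x∉Sg)) ⟩
        cap g + ∣ Z ─ S g ∣            ≡⟨ k≡cap+∣Z─S∣ ⟨
        k                              ∎) (<-irrefl refl)
      where open ≤-Reasoning

    IsFlat⇒S⊆ : ∀ {Z k g} → IsFlat matroid Z → HasRank matroid Z k → Z ⊆ S g →
                k ≡ cap g + ∣ Z ─ S g ∣ → S g ⊆ Z
    IsFlat⇒S⊆ {Z} {k} {g} Z-flat Z-rank Z⊆Sg k≡cap+∣Z─S∣ {y} y∈Sg with y ∈? Z
    ... | yes y∈Z = y∈Z
    ... | no y∉Z =
      ⊥-elim $ Z-flat y y∉Z k Z-rank (subst (HasRank matroid (⁅ y ⁆ ∪ Z)) (≤-antisym k′≤k k≤k′) Z+y-rank)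
      where
      open ≤-Reasoning
      k′ : ℕ
      k′ = proj₁ (rank-exists matroid (⁅ y ⁆ ∪ Z))
      Z+y-rank : HasRank matroid (⁅ y ⁆ ∪ Z) k′
      Z+y-rank = proj₂ (rank-exists matroid (⁅ y ⁆ ∪ Z))
      k≤k′ : k ≤ k′
      k≤k′ = HasRank-mono matroid (q⊆p∪q ⁅ y ⁆ Z) Z-rank Z+y-rank
      k′≤k : k′ ≤ k
      k′≤k = begin
        k′                              ≤⟨ HasRank⇒≤cap+∣─∣ Z+y-rank g ⟩
        cap g + ∣ (⁅ y ⁆ ∪ Z) ─ S g ∣   ≡⟨ cong (cap g +_) (p⊆q⇒∣p─q∣≡0 (⁅x⁆∪p⊆q y∈Sg Z⊆Sg)) ⟩
        cap g + 0                       ≡⟨ cong (cap g +_) (p⊆q⇒∣p─q∣≡0 Z⊆Sg) ⟨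
        cap g + ∣ Z ─ S g ∣             ≡⟨ k≡cap+∣Z─S∣ ⟨
        k                               ∎

    IsCyclicFlat⇒member : ∀ {Z} → IsCyclicFlat matroid Z → Empty Z ⊎ ∃ λ g → Z ≡ S g
    IsCyclicFlat⇒member {Z} (Z-flat , Z-cyclic) with rank-attained Z
    ... | k , ((I , I⊆Z , I-ind , ∣I∣≡k) , _) , inj₁ k≡∣Z∣ =
      inj₁ (IsCyclic∧Independent⇒Empty matroid Z-cyclic
              (subst (Independent matroid) (⊆-antisym I⊆Z Z⊆I) I-ind))
      where
      Z⊆I : Z ⊆ I
      Z⊆I = p⊆q⇒∣q∣≤∣p∣⇒q⊆p I⊆Z (≤-reflexive (trans (sym k≡∣Z∣) (sym ∣I∣≡k)))
    ... | k , Z-rank , inj₂ (g , k≡cap+∣Z─S∣) =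
      let Z⊆Sg = IsCyclic⇒⊆S Z-cyclic Z-rank k≡cap+∣Z─S∣
      in inj₂ (g , ⊆-antisym Z⊆Sg (IsFlat⇒S⊆ Z-flat Z-rank Z⊆Sg k≡cap+∣Z─S∣))

    module _ {f} (condition : CyclicFlatCondition f) where
      open CyclicFlatCondition condition

      cap≤cap+∣S─S-e∣ : ∀ g e → cap f ≤ cap g + ∣ (S f - e) ─ S g ∣
      cap≤cap+∣S─S-e∣ g e with above-or-slack g
      ... | inj₁ (_ , cap≤ , _) = ≤-trans cap≤ (m≤m+n (cap g) _)
      ... | inj₂ cap<cap+∣S─S∣ = s≤s⁻¹ (begin
        suc (cap f)                        ≤⟨ cap<cap+∣S─S∣ ⟩
        cap g + ∣ S f ─ S g ∣              ≤⟨ +-monoʳ-≤ (cap g) (∣p∣≤1+∣p-x∣ (S f ─ S g) e) ⟩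
        cap g + suc ∣ (S f ─ S g) - e ∣    ≡⟨ +-suc (cap g) _ ⟩
        suc (cap g + ∣ (S f ─ S g) - e ∣)  ≡⟨ cong (λ s → suc (cap g + ∣ s ∣)) ([p-x]─q≡[p─q]-x (S f) (S g) e) ⟨
        suc (cap g + ∣ (S f - e) ─ S g ∣)  ∎)
        where open ≤-Reasoning

      cap≤cap+∣S─S∣ : ∀ g → cap f ≤ cap g + ∣ S f ─ S g ∣
      cap≤cap+∣S─S∣ g with above-or-slack g
      ... | inj₁ (_ , cap≤ , _) = ≤-trans cap≤ (m≤m+n (cap g) _)
      ... | inj₂ cap<cap+∣S─S∣ = <⇒≤ cap<cap+∣S─S∣

      condition⇒HasRank : HasRank matroid (S f) (cap f)
      condition⇒HasRank =
        let k , Sf-rank = rank-exists matroid (S f)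
            k≤cap = subst (k ≤_) (trans (cong (cap f +_) (p⊆q⇒∣p─q∣≡0 {p = S f} ⊆-refl)) (+-identityʳ (cap f)))
                          (HasRank⇒≤cap+∣─∣ Sf-rank f)
            cap≤k = ≤HasRank (<⇒≤ cap<∣S∣) cap≤cap+∣S─S∣ Sf-rank
        in subst (HasRank matroid (S f)) (≤-antisym k≤cap cap≤k) Sf-rank

      condition⇒IsCyclic : IsCyclic matroid (S f)
      condition⇒IsCyclic e e∈Sf =
        let k , Sf-e-rank = rank-exists matroid (S f - e)
            k≤cap = HasRank-mono matroid (p─q⊆p (S f) ⁅ e ⁆) Sf-e-rank condition⇒HasRank
            cap≤∣S-e∣ = s≤s⁻¹ (≤-trans cap<∣S∣ (≤-reflexive (sym (x∈p⇒1+∣p-x∣≡∣p∣ e∈Sf))))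
            cap≤k = ≤HasRank cap≤∣S-e∣ (λ g → cap≤cap+∣S─S-e∣ g e) Sf-e-rank
        in same-rank-without⇒circuit matroid e∈Sf
             (subst (HasRank matroid (S f - e)) (≤-antisym k≤cap cap≤k) Sf-e-rank) condition⇒HasRank

      condition⇒IsFlat : IsFlat matroid (S f)
      condition⇒IsFlat e e∉Sf k Sf-rank Sf+e-rank
        rewrite HasRank-unique matroid Sf-rank condition⇒HasRank =
        <-irrefl refl (≤HasRank 1+cap≤∣S+e∣ 1+cap≤cap+∣S+e─S∣ Sf+e-rank)
        where
        1+cap≤∣S+e∣ : suc (cap f) ≤ ∣ ⁅ e ⁆ ∪ S f ∣
        1+cap≤∣S+e∣ = ≤-trans (s≤s (<⇒≤ cap<∣S∣)) (≤-reflexive (sym (x∉p⇒∣⁅x⁆∪p∣≡1+∣p∣ e∉Sf)))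
        1+cap≤cap+∣S+e─S∣ : ∀ g → suc (cap f) ≤ cap g + ∣ (⁅ e ⁆ ∪ S f) ─ S g ∣
        1+cap≤cap+∣S+e─S∣ g with above-or-slack g
        ... | inj₂ cap<cap+∣S─S∣ =
          ≤-trans cap<cap+∣S─S∣ (+-monoʳ-≤ (cap g) (p⊆q⇒∣p∣≤∣q∣ (p⊆q⇒p─r⊆q─r {r = S g} (q⊆p∪q ⁅ e ⁆ (S f)))))
        ... | inj₁ (_ , cap≤cap , Sg⊆Sf⊎cap<cap) with e ∈? S g | Sg⊆Sf⊎cap<cap
        ...   | yes e∈Sg | inj₁ Sg⊆Sf = contradiction (Sg⊆Sf e∈Sg) e∉Sf
        ...   | yes e∈Sg | inj₂ cap<cap = ≤-trans cap<cap (m≤m+n (cap g) _)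
        ...   | no e∉Sg | _ = begin
          suc (cap f)                        ≤⟨ s≤s cap≤cap ⟩
          suc (cap g)                        ≡⟨ +-comm 1 (cap g) ⟩
          cap g + 1                          ≤⟨ +-monoʳ-≤ (cap g) (x∈p⇒0<∣p∣ e∈S+e─Sg) ⟩
          cap g + ∣ (⁅ e ⁆ ∪ S f) ─ S g ∣    ∎
          where
          open ≤-Reasoning
          e∈S+e─Sg : e ∈ (⁅ e ⁆ ∪ S f) ─ S g
          e∈S+e─Sg = x∈p∧x∉q⇒x∈p─q (p⊆p∪q (S f) (x∈⁅x⁆ e)) e∉Sg

      condition⇒IsCyclicFlat : IsCyclicFlat matroid (S f)
      condition⇒IsCyclicFlat = condition⇒IsFlat , condition⇒IsCyclic

-- The construction

ranked : ∀ {k} → Permutation′ k → ℕ → Subset k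
ranked σ i = tabulate (λ x → toℕ (σ ⟨$⟩ʳ x) <ᵇ i)

prefix : ∀ {k} → ℕ → Subset k
prefix = ranked id

module _ {k : ℕ} {σ : Permutation′ k} {i : ℕ} where

  x∈ranked⁻ : ∀ {x} → x ∈ ranked σ i → toℕ (σ ⟨$⟩ʳ x) < i
  x∈ranked⁻ x∈ = <ᵇ⇒< _ _ (Equivalence.from T-≡ (x∈tabulate⁻ x∈))

  x∈ranked⁺ : ∀ {x} → toℕ (σ ⟨$⟩ʳ x) < i → x ∈ ranked σ i
  x∈ranked⁺ σx<i = x∈tabulate⁺ (Equivalence.to T-≡ (<⇒<ᵇ σx<i))

ranked-mono : ∀ {k} (σ : Permutation′ k) {i j} → i ≤ j → ranked σ i ⊆ ranked σ j
ranked-mono σ i≤j x∈ = x∈ranked⁺ {σ = σ} (<-≤-trans (x∈ranked⁻ {σ = σ} x∈) i≤j)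

∣prefix∣ : ∀ {k} i → i ≤ k → ∣ prefix {k} i ∣ ≡ i
∣prefix∣ {zero} zero _ = refl
∣prefix∣ {suc k} zero _ = ∣prefix∣ {k} zero z≤n
∣prefix∣ {suc k} (suc i) (s≤s i≤k) = cong suc (∣prefix∣ {k} i i≤k)

∣ranked∣ : ∀ {k} (σ : Permutation′ k) i → i ≤ k → ∣ ranked σ i ∣ ≡ i
∣ranked∣ σ i i≤k = trans (∣tabulate∘π∣≡∣tabulate∣ (λ y → toℕ y <ᵇ i) σ) (∣prefix∣ i i≤k)

prefix-step : ∀ {k} (i : Fin k) → prefix (suc (toℕ i)) ─ prefix (toℕ i) ≡ ⁅ i ⁆
prefix-step i = ⊆-antisym ⊆⁅i⁆ ⁅i⁆⊆
  where
  ⊆⁅i⁆ : prefix (suc (toℕ i)) ─ prefix (toℕ i) ⊆ ⁅ i ⁆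
  ⊆⁅i⁆ {x} x∈ =
    let x<1+i , x≮i = x∈p─q⁻ (prefix (suc (toℕ i))) (prefix (toℕ i)) x∈
        x≡i = Fin.toℕ-injective (≤-antisym (s≤s⁻¹ (x∈ranked⁻ {σ = id} x<1+i)) (≮⇒≥ (x≮i ∘ x∈ranked⁺ {σ = id})))
    in subst (_∈ ⁅ i ⁆) (sym x≡i) (x∈⁅x⁆ i)
  ⁅i⁆⊆ : ⁅ i ⁆ ⊆ prefix (suc (toℕ i)) ─ prefix (toℕ i)
  ⁅i⁆⊆ x∈ rewrite x∈⁅y⁆⇒x≡y i x∈ =
    x∈p∧x∉q⇒x∈p─q (x∈ranked⁺ {σ = id} ≤-refl) (<-irrefl refl ∘ x∈ranked⁻ {σ = id})

i+i≡j+j⇒i≡j : ∀ i j → i + i ≡ j + j → i ≡ j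
i+i≡j+j⇒i≡j zero zero _ = refl
i+i≡j+j⇒i≡j (suc i) (suc j) eq =
  cong suc (i+i≡j+j⇒i≡j i j (suc-injective (trans (sym (+-suc i i)) (trans (suc-injective eq) (+-suc j j)))))

i+i≢1+j+j : ∀ i j → i + i ≢ suc (j + j)
i+i≢1+j+j (suc zero) (suc j) eq = 0≢1+n (trans (suc-injective (suc-injective eq)) (+-suc j j))
i+i≢1+j+j (suc (suc i)) (suc j) eq =
  i+i≢1+j+j (suc i) j
    (suc-injective (trans (sym (+-suc (suc i) (suc i))) (trans (suc-injective eq) (cong suc (+-suc j j)))))

i+i≤j+j⇒i≤j : ∀ {i j} → i + i ≤ j + j → i ≤ j
i+i≤j+j⇒i≤j {i} {j} i+i≤j+j = ≮⇒≥ λ j<i → <⇒≱ (+-mono-< j<i j<i) i+i≤j+j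

r+r≤U : ∀ {r i j U V} → U + V ≡ (r + i) + (r + j) → V ≤ j + i → r + r ≤ U
r+r≤U {r} {i} {j} {U} {V} U+V≡ V≤j+i = +-cancelʳ-≤ (j + i) (r + r) U (begin
  r + r + (j + i)          ≡⟨ solve 3 (λ r i j → (r :+ r) :+ (j :+ i) := (r :+ i) :+ (r :+ j)) refl r i j ⟩
  (r + i) + (r + j)        ≡⟨ U+V≡ ⟨
  U + V                    ≤⟨ +-monoʳ-≤ U V≤j+i ⟩
  U + (j + i)              ∎)
  where
  open ≤-Reasoning
  open +-*-Solver

module Construction (n : ℕ) where

  a b N : ℕ
  a = suc (suc n)
  b = suc a
  N = a + (b + (n + n))

  N≡4n+5 : N ≡ 4 * n + 5
  N≡4n+5 = solve 1 (λ n → (con 2 :+ n) :+ ((con 3 :+ n) :+ (n :+ n)) := con 4 :* n :+ con 5) refl n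
    where open +-*-Solver

  -- Opaque, so that unification can recover the four blocks of a subset built by blocks.
  opaque
    blocks : Subset a → Subset b → Subset n → Subset n → Subset N
    blocks A B C D = A ++ (B ++ (C ++ D))

  opaque
    unfolding blocks

    blocks-∩ : ∀ A A′ B B′ C C′ D D′ →
               blocks A B C D ∩ blocks A′ B′ C′ D′ ≡ blocks (A ∩ A′) (B ∩ B′) (C ∩ C′) (D ∩ D′)
    blocks-∩ A A′ B B′ C C′ D D′ =
      trans (++-∩ A A′ _ _) (cong ((A ∩ A′) ++_) (trans (++-∩ B B′ _ _) (cong ((B ∩ B′) ++_) (++-∩ C C′ D D′))))

    blocks-─ : ∀ A A′ B B′ C C′ D D′ →
               blocks A B C D ─ blocks A′ B′ C′ D′ ≡ blocks (A ─ A′) (B ─ B′) (C ─ C′) (D ─ D′)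
    blocks-─ A A′ B B′ C C′ D D′ =
      trans (++-─ A A′ _ _) (cong ((A ─ A′) ++_) (trans (++-─ B B′ _ _) (cong ((B ─ B′) ++_) (++-─ C C′ D D′))))

    ∣blocks∣ : ∀ A B C D → ∣ blocks A B C D ∣ ≡ ∣ A ∣ + (∣ B ∣ + (∣ C ∣ + ∣ D ∣))
    ∣blocks∣ A B C D = begin
      ∣ A ++ (B ++ (C ++ D)) ∣           ≡⟨ ∣p++q∣≡∣p∣+∣q∣ A _ ⟩
      ∣ A ∣ + ∣ B ++ (C ++ D) ∣           ≡⟨ cong (∣ A ∣ +_) (∣p++q∣≡∣p∣+∣q∣ B _) ⟩
      ∣ A ∣ + (∣ B ∣ + ∣ C ++ D ∣)        ≡⟨ cong (λ s → ∣ A ∣ + (∣ B ∣ + s)) (∣p++q∣≡∣p∣+∣q∣ C D) ⟩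
      ∣ A ∣ + (∣ B ∣ + (∣ C ∣ + ∣ D ∣))   ∎
      where open ≡-Reasoning

    blocks-⊆ : ∀ {A A′ B B′ C C′ D D′} → A ⊆ A′ → B ⊆ B′ → C ⊆ C′ → D ⊆ D′ →
               blocks A B C D ⊆ blocks A′ B′ C′ D′
    blocks-⊆ A⊆ B⊆ C⊆ D⊆ = ++-⊆ A⊆ (++-⊆ B⊆ (++-⊆ C⊆ D⊆))

    blocks-⊆⁻ᴬ : ∀ {A A′ B B′ C C′ D D′} → blocks A B C D ⊆ blocks A′ B′ C′ D′ → A ⊆ A′
    blocks-⊆⁻ᴬ = ++-⊆⁻ˡ

    blocks-⊆⁻ᴮ : ∀ {A A′ B B′ C C′ D D′} → blocks A B C D ⊆ blocks A′ B′ C′ D′ → B ⊆ B′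
    blocks-⊆⁻ᴮ {A} {A′} = ++-⊆⁻ˡ ∘ ++-⊆⁻ʳ {p = A} {A′}

  ∣blocks─blocks∣ : ∀ A A′ B B′ C C′ D D′ →
    ∣ blocks A B C D ─ blocks A′ B′ C′ D′ ∣ ≡ ∣ A ─ A′ ∣ + (∣ B ─ B′ ∣ + (∣ C ─ C′ ∣ + ∣ D ─ D′ ∣))
  ∣blocks─blocks∣ A A′ B B′ C C′ D D′ =
    trans (cong ∣_∣ (blocks-─ A A′ B B′ C C′ D D′)) (∣blocks∣ (A ─ A′) (B ─ B′) (C ─ C′) (D ─ D′))

  ∣A─A′∣≤∣blocks─blocks∣ : ∀ A A′ B B′ C C′ D D′ → ∣ A ─ A′ ∣ ≤ ∣ blocks A B C D ─ blocks A′ B′ C′ D′ ∣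
  ∣A─A′∣≤∣blocks─blocks∣ A A′ B B′ C C′ D D′ =
    subst (∣ A ─ A′ ∣ ≤_) (sym (∣blocks─blocks∣ A A′ B B′ C C′ D D′)) (m≤m+n ∣ A ─ A′ ∣ _)

  ∣B─B′∣≤∣blocks─blocks∣ : ∀ A A′ B B′ C C′ D D′ → ∣ B ─ B′ ∣ ≤ ∣ blocks A B C D ─ blocks A′ B′ C′ D′ ∣
  ∣B─B′∣≤∣blocks─blocks∣ A A′ B B′ C C′ D D′ =
    subst (∣ B ─ B′ ∣ ≤_) (sym (∣blocks─blocks∣ A A′ B B′ C C′ D D′))
          (≤-trans (m≤m+n ∣ B ─ B′ ∣ _) (m≤n+m _ ∣ A ─ A′ ∣))

  chainX : ℕ → Subset N
  chainX i = blocks ⊤ ∅ (prefix i) (prefix i)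

  chainY : Permutation′ n → ℕ → Subset N
  chainY σ j = blocks ∅ ⊤ (prefix j) (ranked σ j)

  data Label : Set where
    bot top : Label
    X Y : Fin (suc n) → Label

  member : Permutation′ n → Label → Subset N
  member σ bot = ∅
  member σ top = blocks ⊤ ⊤ ⊤ ⊤
  member σ (X i) = chainX (toℕ i)
  member σ (Y j) = chainY σ (toℕ j)

  rank : Label → ℕ
  rank bot = 0
  rank top = suc n + suc n
  rank (X i) = suc n + toℕ i
  rank (Y j) = suc n + toℕ j

  size : Label → ℕ
  size bot = 0
  size top = a + (b + (n + n))
  size (X i) = a + (toℕ i + toℕ i)
  size (Y j) = b + (toℕ j + toℕ j)

  toℕ≤n : ∀ (i : Fin (suc n)) → toℕ i ≤ n
  toℕ≤n = Fin.toℕ≤pred[n]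

  ∣member∣ : ∀ σ ℓ → ∣ member σ ℓ ∣ ≡ size ℓ
  ∣member∣ σ bot = ∣⊥∣≡0 N
  ∣member∣ σ top = trans (∣blocks∣ ⊤ ⊤ ⊤ ⊤)
    (cong₂ _+_ (∣⊤∣≡n a) (cong₂ _+_ (∣⊤∣≡n b) (cong₂ _+_ (∣⊤∣≡n n) (∣⊤∣≡n n))))
  ∣member∣ σ (X i) = trans (∣blocks∣ ⊤ ∅ _ _)
    (cong₂ _+_ (∣⊤∣≡n a) (cong₂ _+_ (∣⊥∣≡0 b) (cong₂ _+_ (∣prefix∣ _ (toℕ≤n i)) (∣prefix∣ _ (toℕ≤n i)))))
  ∣member∣ σ (Y j) = trans (∣blocks∣ ∅ ⊤ _ _)
    (cong₂ _+_ (∣⊥∣≡0 a) (cong₂ _+_ (∣⊤∣≡n b) (cong₂ _+_ (∣prefix∣ _ (toℕ≤n j)) (∣ranked∣ σ _ (toℕ≤n j)))))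

  infix 4 _≼_
  data _≼_ : Label → Label → Set where
    bot≼ : ∀ {ℓ} → bot ≼ ℓ
    ≼top : ∀ {ℓ} → ℓ ≼ top
    X≼X : ∀ {i i′} → toℕ i ≤ toℕ i′ → X i ≼ X i′
    Y≼Y : ∀ {j j′} → toℕ j ≤ toℕ j′ → Y j ≼ Y j′

  member-mono : ∀ σ {ℓ ℓ′} → ℓ ≼ ℓ′ → member σ ℓ ⊆ member σ ℓ′
  member-mono σ {ℓ′ = ℓ′} bot≼ = ⊆-min (member σ ℓ′)
  member-mono σ {bot} ≼top = ⊆-min _
  member-mono σ {top} ≼top = ⊆-refl
  member-mono σ {X i} ≼top = blocks-⊆ ⊆⊤ ⊆⊤ ⊆⊤ ⊆⊤
  member-mono σ {Y j} ≼top = blocks-⊆ ⊆⊤ ⊆⊤ ⊆⊤ ⊆⊤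
  member-mono σ (X≼X i≤i′) = blocks-⊆ ⊆-refl ⊆-refl (ranked-mono id i≤i′) (ranked-mono id i≤i′)
  member-mono σ (Y≼Y j≤j′) = blocks-⊆ ⊆-refl ⊆-refl (ranked-mono id j≤j′) (ranked-mono σ j≤j′)

  ⊤⊈∅ : ∀ {k} → ¬ ⊤ {suc k} ⊆ ∅
  ⊤⊈∅ ⊤⊆∅ = ∉⊥ (⊤⊆∅ here)

  member⊈∅ : ∀ σ ℓ → 0 < size ℓ → ¬ member σ ℓ ⊆ ∅
  member⊈∅ σ ℓ 0<size ⊆∅ = <⇒≱ 0<size (subst₂ _≤_ (∣member∣ σ ℓ) (∣⊥∣≡0 N) (p⊆q⇒∣p∣≤∣q∣ ⊆∅))

  member-⊆⇒≼ : ∀ σ ℓ ℓ′ → member σ ℓ ⊆ member σ ℓ′ → ℓ ≼ ℓ′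
  member-⊆⇒≼ σ bot ℓ′ _ = bot≼
  member-⊆⇒≼ σ ℓ top _ = ≼top
  member-⊆⇒≼ σ top bot ℓ⊆ℓ′ = ⊥-elim (member⊈∅ σ top (s≤s z≤n) ℓ⊆ℓ′)
  member-⊆⇒≼ σ (X i) bot ℓ⊆ℓ′ = ⊥-elim (member⊈∅ σ (X i) (s≤s z≤n) ℓ⊆ℓ′)
  member-⊆⇒≼ σ (Y j) bot ℓ⊆ℓ′ = ⊥-elim (member⊈∅ σ (Y j) (s≤s z≤n) ℓ⊆ℓ′)
  member-⊆⇒≼ σ top (X i) ℓ⊆ℓ′ = ⊥-elim (⊤⊈∅ (blocks-⊆⁻ᴮ ℓ⊆ℓ′))
  member-⊆⇒≼ σ top (Y j) ℓ⊆ℓ′ = ⊥-elim (⊤⊈∅ (blocks-⊆⁻ᴬ ℓ⊆ℓ′))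
  member-⊆⇒≼ σ (X i) (Y j) ℓ⊆ℓ′ = ⊥-elim (⊤⊈∅ (blocks-⊆⁻ᴬ ℓ⊆ℓ′))
  member-⊆⇒≼ σ (Y j) (X i) ℓ⊆ℓ′ = ⊥-elim (⊤⊈∅ (blocks-⊆⁻ᴮ ℓ⊆ℓ′))
  member-⊆⇒≼ σ (X i) (X i′) ℓ⊆ℓ′ =
    X≼X (i+i≤j+j⇒i≤j (+-cancelˡ-≤ a _ _ (subst₂ _≤_ (∣member∣ σ (X i)) (∣member∣ σ (X i′)) (p⊆q⇒∣p∣≤∣q∣ ℓ⊆ℓ′))))
  member-⊆⇒≼ σ (Y j) (Y j′) ℓ⊆ℓ′ =
    Y≼Y (i+i≤j+j⇒i≤j (+-cancelˡ-≤ b _ _ (subst₂ _≤_ (∣member∣ σ (Y j)) (∣member∣ σ (Y j′)) (p⊆q⇒∣p∣≤∣q∣ ℓ⊆ℓ′))))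

  size-injective : ∀ ℓ ℓ′ → size ℓ ≡ size ℓ′ → ℓ ≡ ℓ′
  size-injective bot bot _ = refl
  size-injective top top _ = refl
  size-injective (X i) (X i′) eq = cong X (Fin.toℕ-injective (i+i≡j+j⇒i≡j _ _ (+-cancelˡ-≡ a _ _ eq)))
  size-injective (Y j) (Y j′) eq = cong Y (Fin.toℕ-injective (i+i≡j+j⇒i≡j _ _ (+-cancelˡ-≡ b _ _ eq)))
  size-injective (X i) (Y j) eq =
    contradiction (+-cancelˡ-≡ a _ _ (trans eq (sym (+-suc a _)))) (i+i≢1+j+j (toℕ i) (toℕ j))
  size-injective (Y j) (X i) eq =
    contradiction (+-cancelˡ-≡ a _ _ (trans (sym eq) (sym (+-suc a _)))) (i+i≢1+j+j (toℕ i) (toℕ j))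
  size-injective (X i) top eq = contradiction (+-cancelˡ-≡ a _ _ eq) (<⇒≢ (X<top i))
    where
    X<top : ∀ i → toℕ i + toℕ i < b + (n + n)
    X<top i = ≤-<-trans (+-mono-≤ (toℕ≤n i) (toℕ≤n i)) (m<n+m (n + n) {b} z<s)
  size-injective top (X i) eq = sym (size-injective (X i) top (sym eq))
  size-injective (Y j) top eq = contradiction eq (<⇒≢ (Y<top j))
    where
    Y<top : ∀ j → b + (toℕ j + toℕ j) < a + (b + (n + n))
    Y<top j = ≤-<-trans (+-monoʳ-≤ b (+-mono-≤ (toℕ≤n j) (toℕ≤n j))) (m<n+m (b + (n + n)) {a} z<s)
  size-injective top (Y j) eq = sym (size-injective (Y j) top (sym eq))
  size-injective bot (X _) ()
  size-injective bot (Y _) ()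
  size-injective bot top ()
  size-injective (X _) bot ()
  size-injective (Y _) bot ()
  size-injective top bot ()

  labels : List Label
  labels = bot ∷ top ∷ map X (allFin (suc n)) ++ˡ map Y (allFin (suc n))

  labels-complete : ∀ ℓ → ℓ ∈ˡ labels
  labels-complete bot = here refl
  labels-complete top = there (here refl)
  labels-complete (X i) = there (there (∈-++⁺ˡ (∈-map⁺ X (∈-allFin i))))
  labels-complete (Y j) = there (there (∈-++⁺ʳ (map X (allFin (suc n))) (∈-map⁺ Y (∈-allFin j))))

  labelOfSizeIn : List Label → ℕ → Label
  labelOfSizeIn [] s = bot
  labelOfSizeIn (ℓ ∷ ℓs) s = if ⌊ size ℓ ≟ s ⌋ then ℓ else labelOfSizeIn ℓs s

  labelOfSizeIn-size : ∀ {ℓs} ℓ → ℓ ∈ˡ ℓs → labelOfSizeIn ℓs (size ℓ) ≡ ℓ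
  labelOfSizeIn-size {ℓ′ ∷ ℓs} ℓ ℓ∈ with size ℓ′ ≟ size ℓ | ℓ∈
  ... | yes eq | _ = size-injective ℓ′ ℓ eq
  ... | no neq | here refl = contradiction refl neq
  ... | no neq | there ℓ∈ℓs = labelOfSizeIn-size ℓ ℓ∈ℓs

  labelOfSize : ℕ → Label
  labelOfSize = labelOfSizeIn labels

  labelOfSize-size : ∀ ℓ → labelOfSize (size ℓ) ≡ ℓ
  labelOfSize-size ℓ = labelOfSizeIn-size ℓ (labels-complete ℓ)

  Comparable : Label → Label → Set
  Comparable ℓ ℓ′ = ℓ ≼ ℓ′ ⊎ ℓ′ ≼ ℓ

  X-comparable : ∀ i i′ → Comparable (X i) (X i′)
  X-comparable i i′ = Sum.map X≼X X≼X (≤-total (toℕ i) (toℕ i′))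

  Y-comparable : ∀ j j′ → Comparable (Y j) (Y j′)
  Y-comparable j j′ = Sum.map Y≼Y Y≼Y (≤-total (toℕ j) (toℕ j′))

  data Crossing : Label → Label → Set where
    X,Y : ∀ {i j} → Crossing (X i) (Y j)
    Y,X : ∀ {i j} → Crossing (Y j) (X i)

  comparable-or-crossing : ∀ ℓ ℓ′ → Comparable ℓ ℓ′ ⊎ Crossing ℓ ℓ′
  comparable-or-crossing bot _ = inj₁ (inj₁ bot≼)
  comparable-or-crossing _ bot = inj₁ (inj₂ bot≼)
  comparable-or-crossing top _ = inj₁ (inj₂ ≼top)
  comparable-or-crossing _ top = inj₁ (inj₁ ≼top)
  comparable-or-crossing (X i) (X i′) = inj₁ (X-comparable i i′)
  comparable-or-crossing (Y j) (Y j′) = inj₁ (Y-comparable j j′)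
  comparable-or-crossing (X i) (Y j) = inj₂ X,Y
  comparable-or-crossing (Y j) (X i) = inj₂ Y,X

  two-of-three-comparable : ∀ ℓ₁ ℓ₂ ℓ₃ → Comparable ℓ₁ ℓ₂ ⊎ Comparable ℓ₁ ℓ₃ ⊎ Comparable ℓ₂ ℓ₃
  two-of-three-comparable ℓ₁ ℓ₂ ℓ₃ with comparable-or-crossing ℓ₁ ℓ₂ | comparable-or-crossing ℓ₁ ℓ₃
  ... | inj₁ ℓ₁~ℓ₂ | _ = inj₁ ℓ₁~ℓ₂
  ... | inj₂ _ | inj₁ ℓ₁~ℓ₃ = inj₂ (inj₁ ℓ₁~ℓ₃)
  ... | inj₂ X,Y | inj₂ X,Y = inj₂ (inj₂ (Y-comparable _ _))
  ... | inj₂ Y,X | inj₂ Y,X = inj₂ (inj₂ (X-comparable _ _))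

  ∣⊤─∅∣ : ∀ k → ∣ ⊤ {k} ─ ∅ ∣ ≡ k
  ∣⊤─∅∣ k = trans (cong ∣_∣ (p─⊥≡p (⊤ {k}))) (∣⊤∣≡n k)

  wide-gap : ∀ {i j D} → i ≤ suc n → a ≤ D → suc n + i < suc n + j + D
  wide-gap {i} {j} {D} i≤1+n a≤D = begin-strict
    suc n + i         ≤⟨ +-monoʳ-≤ (suc n) i≤1+n ⟩
    suc n + suc n     <⟨ +-monoʳ-< (suc n) ≤-refl ⟩
    suc n + a         ≤⟨ +-monoʳ-≤ (suc n) a≤D ⟩
    suc n + D         ≤⟨ +-monoˡ-≤ D (m≤m+n (suc n) j) ⟩
    suc n + j + D     ∎
    where open ≤-Reasoning

  -- For nested members the size grows twice as fast as the rank.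
  nested-gap : ∀ {S S′ : Subset N} {c i i′} → S′ ⊆ S → ∣ S ∣ ≡ c + (i + i) → ∣ S′ ∣ ≡ c + (i′ + i′) →
               i′ < i → suc n + i < suc n + i′ + ∣ S ─ S′ ∣
  nested-gap {S} {S′} {c} {i} {i′} S′⊆S ∣S∣≡ ∣S′∣≡ i′<i =
    subst (suc n + i <_) (sym (+-assoc (suc n) i′ _))
          (+-monoʳ-< (suc n) (≰⇒> λ i′+D≤i → <⇒≱ (+-monoˡ-< i i′<i) (i+i≤i′+i i′+D≤i)))
    where
    D : ℕ
    D = ∣ S ─ S′ ∣
    i+i≡i′+i′+D : i + i ≡ i′ + i′ + D
    i+i≡i′+i′+D = +-cancelˡ-≡ c _ _ (begin
      c + (i + i)            ≡⟨ ∣S∣≡ ⟨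
      ∣ S ∣                  ≡⟨ q⊆p⇒∣p∣≡∣q∣+∣p─q∣ S′⊆S ⟩
      ∣ S′ ∣ + D             ≡⟨ cong (_+ D) ∣S′∣≡ ⟩
      c + (i′ + i′) + D      ≡⟨ +-assoc c _ D ⟩
      c + (i′ + i′ + D)      ∎)
      where open ≡-Reasoning
    i+i≤i′+i : i′ + D ≤ i → i + i ≤ i′ + i
    i+i≤i′+i i′+D≤i = begin
      i + i              ≡⟨ i+i≡i′+i′+D ⟩
      i′ + i′ + D        ≡⟨ +-assoc i′ i′ D ⟩
      i′ + (i′ + D)      ≤⟨ +-monoʳ-≤ i′ i′+D≤i ⟩
      i′ + i             ∎
      where open ≤-Reasoning

  module _ (σ : Permutation′ n) where
    open FromCapacities (member σ) rank labels labels-complete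

    ∣X∩Y∣≤ : ∀ i j → ∣ chainX (toℕ i) ∩ chainY σ (toℕ j) ∣ ≤ toℕ j + toℕ i
    ∣X∩Y∣≤ i j = begin
      ∣ chainX (toℕ i) ∩ chainY σ (toℕ j) ∣
        ≡⟨ cong ∣_∣ (blocks-∩ ⊤ ∅ ∅ ⊤ (prefix (toℕ i)) (prefix (toℕ j)) (prefix (toℕ i)) (ranked σ (toℕ j))) ⟩
      ∣ blocks (⊤ ∩ ∅) (∅ ∩ ⊤) (P ∩ prefix (toℕ j)) (P ∩ ranked σ (toℕ j)) ∣
        ≡⟨ ∣blocks∣ (⊤ ∩ ∅) (∅ ∩ ⊤) _ _ ⟩
      ∣ ⊤ {a} ∩ ∅ ∣ + (∣ ∅ {b} ∩ ⊤ ∣ + (∣ P ∩ prefix (toℕ j) ∣ + ∣ P ∩ ranked σ (toℕ j) ∣))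
        ≡⟨ cong₂ (λ s t → ∣ s ∣ + (∣ t ∣ + R)) (∩-zeroʳ (⊤ {a})) (∩-zeroˡ (⊤ {b})) ⟩
      ∣ ∅ {a} ∣ + (∣ ∅ {b} ∣ + R)
        ≡⟨ cong₂ (λ s t → s + (t + R)) (∣⊥∣≡0 a) (∣⊥∣≡0 b) ⟩
      ∣ P ∩ prefix (toℕ j) ∣ + ∣ P ∩ ranked σ (toℕ j) ∣
        ≤⟨ +-mono-≤ (≤-trans (∣p∩q∣≤∣q∣ P _) (≤-reflexive (∣prefix∣ _ (toℕ≤n j))))
                    (≤-trans (∣p∩q∣≤∣p∣ P _) (≤-reflexive (∣prefix∣ _ (toℕ≤n i)))) ⟩
      toℕ j + toℕ i
        ∎
      where
      open ≤-Reasoning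
      P : Subset n
      P = prefix (toℕ i)
      R : ℕ
      R = ∣ P ∩ prefix (toℕ j) ∣ + ∣ P ∩ ranked σ (toℕ j) ∣

    crossing-tight : ∀ {I i j} → WithinCapacity I → Tight I (X i) → Tight I (Y j) → Tight I top
    crossing-tight {I} {i} {j} I-within X-tight Y-tight = ≤-antisym (I-within top) (begin
      suc n + suc n                     ≤⟨ r+r≤U {suc n} {toℕ i} {toℕ j} U+V≡ V≤j+i ⟩
      ∣ I ∩ (Xi ∪ Yj) ∣                 ≤⟨ p⊆q⇒∣p∣≤∣q∣ (λ x∈ → let x∈I , x∈X∪Y = x∈p∩q⁻ I _ x∈
                                                             in x∈p∩q⁺ (x∈I , ⊆top x∈X∪Y)) ⟩
      ∣ I ∩ member σ top ∣              ∎)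
      where
      open ≤-Reasoning
      Xi Yj : Subset N
      Xi = chainX (toℕ i)
      Yj = chainY σ (toℕ j)
      U+V≡ : ∣ I ∩ (Xi ∪ Yj) ∣ + ∣ I ∩ (Xi ∩ Yj) ∣ ≡ rank (X i) + rank (Y j)
      U+V≡ = trans (∣r∩[p∪q]∣+∣r∩[p∩q]∣≡∣r∩p∣+∣r∩q∣ I Xi Yj) (cong₂ _+_ X-tight Y-tight)
      V≤j+i : ∣ I ∩ (Xi ∩ Yj) ∣ ≤ toℕ j + toℕ i
      V≤j+i = ≤-trans (∣p∩q∣≤∣q∣ I (Xi ∩ Yj)) (∣X∩Y∣≤ i j)
      ⊆top : Xi ∪ Yj ⊆ member σ top
      ⊆top x∈ with x∈p∪q⁻ Xi Yj x∈
      ... | inj₁ x∈X = member-mono σ {X i} ≼top x∈X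
      ... | inj₂ x∈Y = member-mono σ {Y j} ≼top x∈Y

    tight-directed : ∀ I → WithinCapacity I → ∀ ℓ ℓ′ → Tight I ℓ → Tight I ℓ′ →
                     ∃ λ w → Tight I w × member σ ℓ ⊆ member σ w × member σ ℓ′ ⊆ member σ w
    tight-directed I I-within ℓ ℓ′ ℓ-tight ℓ′-tight with comparable-or-crossing ℓ ℓ′
    ... | inj₁ (inj₁ ℓ≼ℓ′) = ℓ′ , ℓ′-tight , member-mono σ ℓ≼ℓ′ , ⊆-refl
    ... | inj₁ (inj₂ ℓ′≼ℓ) = ℓ , ℓ-tight , ⊆-refl , member-mono σ ℓ′≼ℓ
    ... | inj₂ X,Y =
      top , crossing-tight {I} I-within ℓ-tight ℓ′-tight , member-mono σ {ℓ} ≼top , member-mono σ {ℓ′} ≼top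
    ... | inj₂ Y,X =
      top , crossing-tight {I} I-within ℓ′-tight ℓ-tight , member-mono σ {ℓ} ≼top , member-mono σ {ℓ′} ≼top

    open Directed tight-directed

    M : Matroid N
    M = matroid

    module _ (C : Fin (suc n) → Label) (c : ℕ) (C-mono : ∀ {i i′} → toℕ i ≤ toℕ i′ → C i ≼ C i′)
             (rank-C : ∀ i → rank (C i) ≡ suc n + toℕ i) (size-C : ∀ i → size (C i) ≡ c + (toℕ i + toℕ i)) where

      same-chain : ∀ i i′ → Above (C i) (C i′) ⊎ Slack (C i) (C i′)
      same-chain i i′ rewrite rank-C i | rank-C i′ with <-cmp (toℕ i) (toℕ i′)
      ... | tri< i<i′ _ _ =
        inj₁ (member-mono σ (C-mono (<⇒≤ i<i′)) , +-monoʳ-≤ (suc n) (<⇒≤ i<i′) , inj₂ (+-monoʳ-< (suc n) i<i′))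
      ... | tri≈ _ i≡i′ _ =
        inj₁ (member-mono σ (C-mono (≤-reflexive i≡i′)) , +-monoʳ-≤ (suc n) (≤-reflexive i≡i′)
             , inj₁ (member-mono σ (C-mono (≤-reflexive (sym i≡i′)))))
      ... | tri> _ _ i′<i =
        inj₂ (nested-gap {c = c} (member-mono σ (C-mono (<⇒≤ i′<i))) (trans (∣member∣ σ (C i)) (size-C i))
                         (trans (∣member∣ σ (C i′)) (size-C i′)) i′<i)

    Slack-bot : ∀ {ℓ} → rank ℓ < ∣ member σ ℓ ∣ → Slack ℓ bot
    Slack-bot {ℓ} rank<∣S∣ = subst (rank ℓ <_) (cong ∣_∣ (sym (p─⊥≡p (member σ ℓ)))) rank<∣S∣

    a≤∣X─Y∣ : ∀ i j → a ≤ ∣ member σ (X i) ─ member σ (Y j) ∣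
    a≤∣X─Y∣ i j = ≤-trans (≤-reflexive (sym (∣⊤─∅∣ a)))
      (∣A─A′∣≤∣blocks─blocks∣ ⊤ ∅ ∅ ⊤ (prefix (toℕ i)) (prefix (toℕ j)) (prefix (toℕ i)) (ranked σ (toℕ j)))

    a≤∣Y─X∣ : ∀ j i → a ≤ ∣ member σ (Y j) ─ member σ (X i) ∣
    a≤∣Y─X∣ j i = ≤-trans (≤-trans (n≤1+n a) (≤-reflexive (sym (∣⊤─∅∣ b))))
      (∣B─B′∣≤∣blocks─blocks∣ ∅ ⊤ ⊤ ∅ (prefix (toℕ j)) (prefix (toℕ i)) (ranked σ (toℕ j)) (prefix (toℕ i)))

    a≤∣top─X∣ : ∀ i → a ≤ ∣ member σ top ─ member σ (X i) ∣
    a≤∣top─X∣ i = ≤-trans (≤-trans (n≤1+n a) (≤-reflexive (sym (∣⊤─∅∣ b))))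
      (∣B─B′∣≤∣blocks─blocks∣ ⊤ ⊤ ⊤ ∅ ⊤ (prefix (toℕ i)) ⊤ (prefix (toℕ i)))

    a≤∣top─Y∣ : ∀ j → a ≤ ∣ member σ top ─ member σ (Y j) ∣
    a≤∣top─Y∣ j = ≤-trans (≤-reflexive (sym (∣⊤─∅∣ a)))
      (∣A─A′∣≤∣blocks─blocks∣ ⊤ ∅ ⊤ ⊤ ⊤ (prefix (toℕ j)) ⊤ (ranked σ (toℕ j)))

    below-top : ∀ {ℓ} → rank ℓ < rank top → Above ℓ top
    below-top {ℓ} rank<rank = member-mono σ {ℓ} ≼top , <⇒≤ rank<rank , inj₂ rank<rank

    X-condition : ∀ i → CyclicFlatCondition (X i)
    X-condition i = record
      { cap<∣S∣        = rank<∣S∣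
      ; above-or-slack = λ where
          bot → inj₂ (Slack-bot {X i} rank<∣S∣)
          top → inj₁ (below-top {X i} (+-monoʳ-< (suc n) (s≤s (toℕ≤n i))))
          (X i′) → same-chain X a X≼X (λ _ → refl) (λ _ → refl) i i′
          (Y j) → inj₂ (wide-gap (m≤n⇒m≤1+n (toℕ≤n i)) (a≤∣X─Y∣ i j))
      }
      where
      rank<∣S∣ : rank (X i) < ∣ member σ (X i) ∣
      rank<∣S∣ = subst (rank (X i) <_) (sym (∣member∣ σ (X i))) (+-monoʳ-≤ a (m≤m+n (toℕ i) (toℕ i)))

    Y-condition : ∀ j → CyclicFlatCondition (Y j)
    Y-condition j = record
      { cap<∣S∣        = rank<∣S∣
      ; above-or-slack = λ where
          bot → inj₂ (Slack-bot {Y j} rank<∣S∣)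
          top → inj₁ (below-top {Y j} (+-monoʳ-< (suc n) (s≤s (toℕ≤n j))))
          (Y j′) → same-chain Y b Y≼Y (λ _ → refl) (λ _ → refl) j j′
          (X i) → inj₂ (wide-gap (m≤n⇒m≤1+n (toℕ≤n j)) (a≤∣Y─X∣ j i))
      }
      where
      rank<∣S∣ : rank (Y j) < ∣ member σ (Y j) ∣
      rank<∣S∣ = subst (rank (Y j) <_) (sym (∣member∣ σ (Y j)))
                       (m≤n⇒m≤1+n (+-monoʳ-≤ a (m≤m+n (toℕ j) (toℕ j))))

    top-condition : CyclicFlatCondition top
    top-condition = record
      { cap<∣S∣        = rank<∣S∣
      ; above-or-slack = λ where
          bot → inj₂ (Slack-bot {top} rank<∣S∣)
          top → inj₁ (⊆-refl , ≤-refl , inj₁ ⊆-refl)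
          (X i) → inj₂ (wide-gap ≤-refl (a≤∣top─X∣ i))
          (Y j) → inj₂ (wide-gap ≤-refl (a≤∣top─Y∣ j))
      }
      where
      rank<∣S∣ : rank top < ∣ member σ top ∣
      rank<∣S∣ = subst (rank top <_) (sym (∣member∣ σ top))
                       (+-monoʳ-≤ a (≤-trans (m≤n⇒m≤1+n (n≤1+n (suc n))) (m≤m+n b (n + n))))

    loopless : ∀ e → Independent M ⁅ e ⁆
    loopless e = within⇒indep ⁅ e ⁆ λ where
        bot → ≤-reflexive (trans (cong ∣_∣ (∩-zeroʳ ⁅ e ⁆)) (∣⊥∣≡0 N))
        top → ⁅e⁆∩S≤rank top (s≤s z≤n)
        (X i) → ⁅e⁆∩S≤rank (X i) (s≤s z≤n)
        (Y j) → ⁅e⁆∩S≤rank (Y j) (s≤s z≤n)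
      where
      ⁅e⁆∩S≤rank : ∀ ℓ → 1 ≤ rank ℓ → ∣ ⁅ e ⁆ ∩ member σ ℓ ∣ ≤ rank ℓ
      ⁅e⁆∩S≤rank ℓ 1≤rank = ≤-trans (∣p∩q∣≤∣p∣ ⁅ e ⁆ (member σ ℓ)) (≤-trans (≤-reflexive (∣⁅x⁆∣≡1 e)) 1≤rank)

    member-isCyclicFlat : ∀ ℓ → IsCyclicFlat M (member σ ℓ)
    member-isCyclicFlat bot = loopless⇒∅-isCyclicFlat M loopless
    member-isCyclicFlat top = condition⇒IsCyclicFlat {top} top-condition
    member-isCyclicFlat (X i) = condition⇒IsCyclicFlat {X i} (X-condition i)
    member-isCyclicFlat (Y j) = condition⇒IsCyclicFlat {Y j} (Y-condition j)

    isCyclicFlat⇒member : ∀ {Z} → IsCyclicFlat M Z → ∃ λ ℓ → Z ≡ member σ ℓ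
    isCyclicFlat⇒member {Z} Z-cyclicFlat =
      [ (λ Z-empty → bot , Empty-unique Z-empty) , (λ (ℓ , Z≡Sℓ) → ℓ , Z≡Sℓ) ]′
        (IsCyclicFlat⇒member {Z} Z-cyclicFlat)

  IsCyclicFlat-elim : ∀ σ (P : Subset N → Set) → (∀ ℓ → P (member σ ℓ)) → ∀ {Z} → IsCyclicFlat (M σ) Z → P Z
  IsCyclicFlat-elim σ P P-member Z-cf =
    let ℓ , Z≡Sℓ = isCyclicFlat⇒member σ Z-cf in subst P (sym Z≡Sℓ) (P-member ℓ)

  ¬incomparable : ∀ σ {ℓ ℓ′ Z Z′} → Comparable ℓ ℓ′ → Z ≡ member σ ℓ → Z′ ≡ member σ ℓ′ →
                  ¬ (¬ Z ⊆ Z′ × ¬ Z′ ⊆ Z)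
  ¬incomparable σ (inj₁ ℓ≼ℓ′) refl refl (⊈ , _) = ⊈ (member-mono σ ℓ≼ℓ′)
  ¬incomparable σ (inj₂ ℓ′≼ℓ) refl refl (_ , ⊉) = ⊉ (member-mono σ ℓ′≼ℓ)

  M-cyclicWidth≤2 : ∀ σ → CyclicWidth≤ (M σ) 2
  M-cyclicWidth≤2 σ [] _ = z≤n
  M-cyclicWidth≤2 σ (_ ∷ []) _ = s≤s z≤n
  M-cyclicWidth≤2 σ (_ ∷ _ ∷ []) _ = s≤s (s≤s z≤n)
  M-cyclicWidth≤2 σ (Z₁ ∷ Z₂ ∷ Z₃ ∷ _) ((Z₁-cf ∷ Z₂-cf ∷ Z₃-cf ∷ _) , ((Z₁#Z₂ ∷ Z₁#Z₃ ∷ _) ∷ (Z₂#Z₃ ∷ _) ∷ _)) =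
    let ℓ₁ , Z₁≡ = isCyclicFlat⇒member σ Z₁-cf
        ℓ₂ , Z₂≡ = isCyclicFlat⇒member σ Z₂-cf
        ℓ₃ , Z₃≡ = isCyclicFlat⇒member σ Z₃-cf
    in ⊥-elim ([ (λ ℓ₁~ℓ₂ → ¬incomparable σ ℓ₁~ℓ₂ Z₁≡ Z₂≡ Z₁#Z₂)
              , [ (λ ℓ₁~ℓ₃ → ¬incomparable σ ℓ₁~ℓ₃ Z₁≡ Z₃≡ Z₁#Z₃)
                , (λ ℓ₂~ℓ₃ → ¬incomparable σ ℓ₂~ℓ₃ Z₂≡ Z₃≡ Z₂#Z₃) ]′ ]′ (two-of-three-comparable ℓ₁ ℓ₂ ℓ₃))

  -- Cyclic flats are told apart by their sizes, so relabelling by size moves them between the M σ.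
  relabel : Permutation′ n → Subset N → Subset N
  relabel τ Z = member τ (labelOfSize ∣ Z ∣)

  relabel-member : ∀ σ τ ℓ → relabel τ (member σ ℓ) ≡ member τ ℓ
  relabel-member σ τ ℓ = cong (member τ) (trans (cong labelOfSize (∣member∣ σ ℓ)) (labelOfSize-size ℓ))

  module _ (σ τ : Permutation′ n) where

    relabel-isCyclicFlat : ∀ Z → IsCyclicFlat (M σ) Z → IsCyclicFlat (M τ) (relabel τ Z)
    relabel-isCyclicFlat _ = IsCyclicFlat-elim σ (IsCyclicFlat (M τ) ∘ relabel τ)
      λ ℓ → subst (IsCyclicFlat (M τ)) (sym (relabel-member σ τ ℓ)) (member-isCyclicFlat τ ℓ)

    relabel-relabel : ∀ Z → IsCyclicFlat (M σ) Z → relabel σ (relabel τ Z) ≡ Z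
    relabel-relabel _ = IsCyclicFlat-elim σ (λ Z → relabel σ (relabel τ Z) ≡ Z)
      λ ℓ → trans (cong (relabel σ) (relabel-member σ τ ℓ)) (relabel-member τ σ ℓ)

    relabel-mono : ∀ Z Z′ → IsCyclicFlat (M σ) Z → IsCyclicFlat (M σ) Z′ → Z ⊆ Z′ → relabel τ Z ⊆ relabel τ Z′
    relabel-mono _ _ Z-cf Z′-cf =
      IsCyclicFlat-elim σ (λ Z → ∀ {Z′} → IsCyclicFlat (M σ) Z′ → Z ⊆ Z′ → relabel τ Z ⊆ relabel τ Z′)
      (λ ℓ → IsCyclicFlat-elim σ (λ Z′ → member σ ℓ ⊆ Z′ → relabel τ (member σ ℓ) ⊆ relabel τ Z′)
        λ ℓ′ Sℓ⊆Sℓ′ → subst₂ (λ A B → A ⊆ B) (sym (relabel-member σ τ ℓ)) (sym (relabel-member σ τ ℓ′))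
                                (member-mono τ (member-⊆⇒≼ σ ℓ ℓ′ Sℓ⊆Sℓ′)))
      Z-cf Z′-cf

  cfLatticeIso : ∀ σ τ → CFLatticeIso (M σ) (M τ)
  cfLatticeIso σ τ = record
    { to        = relabel τ
    ; from      = relabel σ
    ; to-cf     = relabel-isCyclicFlat σ τ
    ; from-cf   = relabel-isCyclicFlat τ σ
    ; from-to   = relabel-relabel σ τ
    ; to-from   = relabel-relabel τ σ
    ; to-mono   = relabel-mono σ τ
    ; from-mono = relabel-mono τ σ
    }

  -- (X_{i+1} ─ X_i) ∩ Y_j meets the C block in i iff i < j, and the D block in i iff σ i < j.
  slice : Permutation′ n → Fin n → Fin (suc n) → Subset N
  slice σ i j = (member σ (X (suc i)) ─ member σ (X (inject₁ i))) ∩ member σ (Y j)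

  ∣slice∣ : ∀ σ i j → ∣ slice σ i j ∣ ≡ ∣ ⁅ i ⁆ ∩ prefix (toℕ j) ∣ + ∣ ⁅ i ⁆ ∩ ranked σ (toℕ j) ∣
  ∣slice∣ σ i j = begin
    ∣ (chainX (suc (toℕ i)) ─ chainX (toℕ (inject₁ i))) ∩ chainY σ (toℕ j) ∣
      ≡⟨ cong (λ s → ∣ s ∩ chainY σ (toℕ j) ∣) (blocks-─ ⊤ ⊤ ∅ ∅ P₁ P₀ P₁ P₀) ⟩
    ∣ blocks (⊤ ─ ⊤) (∅ ─ ∅) (P₁ ─ P₀) (P₁ ─ P₀) ∩ chainY σ (toℕ j) ∣
      ≡⟨ cong (λ s → ∣ blocks (⊤ ─ ⊤) (∅ ─ ∅) s s ∩ chainY σ (toℕ j) ∣) step ⟩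
    ∣ blocks (⊤ ─ ⊤) (∅ ─ ∅) ⁅ i ⁆ ⁅ i ⁆ ∩ chainY σ (toℕ j) ∣
      ≡⟨ cong ∣_∣ (blocks-∩ (⊤ ─ ⊤) ∅ (∅ ─ ∅) ⊤ ⁅ i ⁆ (prefix (toℕ j)) ⁅ i ⁆ (ranked σ (toℕ j))) ⟩
    ∣ blocks ((⊤ ─ ⊤) ∩ ∅) ((∅ ─ ∅) ∩ ⊤) (⁅ i ⁆ ∩ prefix (toℕ j)) (⁅ i ⁆ ∩ ranked σ (toℕ j)) ∣
      ≡⟨ ∣blocks∣ ((⊤ ─ ⊤) ∩ ∅) ((∅ ─ ∅) ∩ ⊤) (⁅ i ⁆ ∩ prefix (toℕ j)) (⁅ i ⁆ ∩ ranked σ (toℕ j)) ⟩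
    ∣ (⊤ {a} ─ ⊤) ∩ ∅ ∣ + (∣ (∅ {b} ─ ∅) ∩ ⊤ ∣ + R)
      ≡⟨ cong₂ (λ s t → ∣ s ∣ + (∣ t ∣ + R)) (∩-zeroʳ (⊤ {a} ─ ⊤)) (trans (∩-identityʳ (∅ {b} ─ ∅)) (p─⊥≡p ∅)) ⟩
    ∣ ∅ {a} ∣ + (∣ ∅ {b} ∣ + R)
      ≡⟨ cong₂ (λ s t → s + (t + R)) (∣⊥∣≡0 a) (∣⊥∣≡0 b) ⟩
    R ∎
    where
    open ≡-Reasoning
    P₁ P₀ : Subset n
    P₁ = prefix (suc (toℕ i))
    P₀ = prefix (toℕ (inject₁ i))
    R : ℕ
    R = ∣ ⁅ i ⁆ ∩ prefix (toℕ j) ∣ + ∣ ⁅ i ⁆ ∩ ranked σ (toℕ j) ∣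
    step : P₁ ─ P₀ ≡ ⁅ i ⁆
    step = trans (cong (λ k → P₁ ─ prefix k) (Fin.toℕ-inject₁ i)) (prefix-step i)

  module _ {σ τ} (iso : MatroidIso (M σ) (M τ)) where
    open Σ iso using () renaming (proj₁ to π)

    image-member : ∀ ℓ → image π (member σ ℓ) ≡ member τ ℓ
    image-member ℓ =
      let ℓ′ , πSℓ≡Sℓ′ = isCyclicFlat⇒member τ
                           (image-isCyclicFlat {M = M σ} {N = M τ} iso {member σ ℓ} (member-isCyclicFlat σ ℓ))
          size≡ = begin
            size ℓ′                  ≡⟨ ∣member∣ τ ℓ′ ⟨
            ∣ member τ ℓ′ ∣          ≡⟨ cong ∣_∣ πSℓ≡Sℓ′ ⟨
            ∣ image π (member σ ℓ) ∣ ≡⟨ ∣image∣ π (member σ ℓ) ⟩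
            ∣ member σ ℓ ∣           ≡⟨ ∣member∣ σ ℓ ⟩
            size ℓ                   ∎
      in trans πSℓ≡Sℓ′ (cong (member τ) (size-injective ℓ′ ℓ size≡))
      where open ≡-Reasoning

    ∣slice∣-invariant : ∀ i j → ∣ slice σ i j ∣ ≡ ∣ slice τ i j ∣
    ∣slice∣-invariant i j = begin
      ∣ slice σ i j ∣                ≡⟨ ∣image∣ π (slice σ i j) ⟨
      ∣ image π (slice σ i j) ∣
        ≡⟨ cong ∣_∣ (image-zipWith π _∧_ (Sσ (X (suc i)) ─ Sσ (X (inject₁ i))) (Sσ (Y j))) ⟩
      ∣ image π (Sσ (X (suc i)) ─ Sσ (X (inject₁ i))) ∩ image π (Sσ (Y j)) ∣
        ≡⟨ cong (λ s → ∣ s ∩ image π (Sσ (Y j)) ∣) (image-─ π (Sσ (X (suc i))) (Sσ (X (inject₁ i)))) ⟩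
      ∣ (image π (Sσ (X (suc i))) ─ image π (Sσ (X (inject₁ i)))) ∩ image π (Sσ (Y j)) ∣
        ≡⟨ cong ∣_∣ (cong₂ _∩_ (cong₂ _─_ (image-member (X (suc i))) (image-member (X (inject₁ i))))
                                (image-member (Y j))) ⟩
      ∣ slice τ i j ∣                ∎
      where
      open ≡-Reasoning
      Sσ : Label → Subset N
      Sσ = member σ

    τ≤σ : ∀ i → toℕ (τ ⟨$⟩ʳ i) ≤ toℕ (σ ⟨$⟩ʳ i)
    τ≤σ i with i ∈? ranked τ (suc (toℕ (σ ⟨$⟩ʳ i)))
    ... | yes i∈ = s≤s⁻¹ (x∈ranked⁻ {σ = τ} i∈)
    ... | no i∉ = contradiction (begin
      1                                 ≡⟨ x∈p⇒∣⁅x⁆∩p∣≡1 (x∈ranked⁺ {σ = σ} {i = toℕ j} ≤-refl) ⟨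
      ∣ ⁅ i ⁆ ∩ ranked σ (toℕ j) ∣      ≡⟨ ranked-count≡ ⟩
      ∣ ⁅ i ⁆ ∩ ranked τ (toℕ j) ∣      ≡⟨ x∉p⇒∣⁅x⁆∩p∣≡0 i∉ ⟩
      0                                 ∎) λ ()
      where
      open ≡-Reasoning
      j : Fin (suc n)
      j = suc (σ ⟨$⟩ʳ i)
      ranked-count≡ : ∣ ⁅ i ⁆ ∩ ranked σ (toℕ j) ∣ ≡ ∣ ⁅ i ⁆ ∩ ranked τ (toℕ j) ∣
      ranked-count≡ = +-cancelˡ-≡ ∣ ⁅ i ⁆ ∩ prefix (toℕ j) ∣ _ _
        (trans (sym (∣slice∣ σ i j)) (trans (∣slice∣-invariant i j) (∣slice∣ τ i j)))

  iso⇒≈ : ∀ σ τ → MatroidIso (M σ) (M τ) → σ ≈ τ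
  iso⇒≈ σ τ iso i =
    Fin.toℕ-injective (≤-antisym (τ≤σ {τ} {σ} (MatroidIso-sym {M = M σ} {N = M τ} iso) i) (τ≤σ iso i))

-- Enumerating permutations

permutation : ∀ n → Fin (n !) → Permutation′ n
permutation zero _ = id
permutation (suc n) k = let j , r = remQuot (n !) k in insert zero j (permutation n r)

permutation-injective : ∀ n {k k′} → permutation n k ≈ permutation n k′ → k ≡ k′
permutation-injective zero {zero} {zero} _ = refl
permutation-injective (suc n) {k} {k′} πk≈πk′ = begin
  k                                   ≡⟨ Fin.combine-remQuot (n !) k ⟨
  uncurry combine (remQuot (n !) k)   ≡⟨ cong₂ combine j≡j′ r≡r′ ⟩
  uncurry combine (remQuot (n !) k′)  ≡⟨ Fin.combine-remQuot (n !) k′ ⟩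
  k′                                  ∎
  where
  open ≡-Reasoning
  j≡j′ : proj₁ (remQuot (n !) k) ≡ proj₁ (remQuot (n !) k′)
  j≡j′ = πk≈πk′ zero
  r≡r′ : proj₂ (remQuot {suc n} (n !) k) ≡ proj₂ (remQuot (n !) k′)
  r≡r′ = permutation-injective n λ x →
    Fin.punchIn-injective _ _ _ (trans (πk≈πk′ (suc x)) (cong (λ j → punchIn j _) (sym j≡j′)))

theorem5p7 : (n : ℕ) →
    Σ (Fin (n !) → Matroid (4 * n + 5)) λ M →
      (∀ i j → ¬ i ≡ j → ¬ MatroidIso (M i) (M j))
      × (∀ i → CyclicWidth≤ (M i) 2)
      × (∀ i j → CFLatticeIso (M i) (M j))
theorem5p7 n = subst Claim N≡4n+5
  ( M ∘ permutation n
  , (λ i j i≢j → i≢j ∘ permutation-injective n ∘ iso⇒≈ (permutation n i) (permutation n j))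
  , M-cyclicWidth≤2 ∘ permutation n
  , (λ i j → cfLatticeIso (permutation n i) (permutation n j)) )
  where
  open Construction n
  Claim : ℕ → Set
  Claim m = Σ (Fin (n !) → Matroid m) λ M →
      (∀ i j → ¬ i ≡ j → ¬ MatroidIso (M i) (M j))
      × (∀ i → CyclicWidth≤ (M i) 2)
      × (∀ i j → CFLatticeIso (M i) (M j))
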